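{- For every finite graph $G$ there is a graph $H$ which is $C^2$-equivalent to $G$ and which is multi-circulant with respect to the coarsest equitable partition of $H$.
   Context: Graphs are finite, undirected, without loops. $C^2$ is the $2$-variable fragment of first-order logic with counting quantifiers $\exists^{\ge t}$; two graphs are $C^2$-equivalent if no $C^2$-sentence distinguishes them. A partition $\Pi$ of $V(H)$ is equitable if for all $P,Q\in\Pi$ all vertices of $P$ have the same number of neighbors in $Q$. A graph is multi-circulant with respect to a partition $\{P_1,\dots,P_\ell\}$ of its vertex set if it has an automorphism whose cycle decomposition (as a permutation, counting fixed points as cycles of length $1$) consists of exactly $\ell$ cycles, the $i$-th cycle being on $P_i$. -}

module Defs where

open import Data.Nat using (ℕ; zero; suc; _+_; _≤ᵇ_)
open import Data.Bool using (Bool; true; false; if_then_else_; _∧_; _∨_; not)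
open import Data.Fin using (Fin; zero; suc; _≟_)
open import Data.Fin.Permutation using (Permutation′; _⟨$⟩ʳ_)
open import Data.Maybe using (Maybe; just; nothing)
open import Data.Product using (Σ; _×_; ∃; ∃-syntax)
open import Function using (_∘_)
open import Relation.Nullary.Decidable using (⌊_⌋)
open import Relation.Binary.PropositionalEquality using (_≡_)

record Graph : Set where
  field
    n     : ℕ
    E     : Fin n → Fin n → Bool
    sym   : ∀ u v → E u v ≡ E v u
    loopless : ∀ u → E u u ≡ false

open Graph public

V : Graph → Set
V G = Fin (n G)

countB : ∀ {m} → (Fin m → Bool) → ℕ
countB {zero}  f = 0
countB {suc m} f = (if f zero then 1 else 0) + countB (f ∘ suc)

data Var : Set where
  vx vy : Var

_==V_ : Var → Var → Bool
vx ==V vx = true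
vy ==V vy = true
_  ==V _  = false

data Formula : Set where
  eqF   : Var → Var → Formula
  edgeF : Var → Var → Formula
  negF  : Formula → Formula
  andF  : Formula → Formula → Formula
  cntF  : ℕ → Var → Formula → Formula   -- ∃^{≥ t} z . φ

free : Var → Formula → Bool
free z (eqF a b)    = (a ==V z) ∨ (b ==V z)
free z (edgeF a b)  = (a ==V z) ∨ (b ==V z)
free z (negF φ)     = free z φ
free z (andF φ ψ)   = free z φ ∨ free z ψ
free z (cntF t w φ) = if w ==V z then false else free z φ

Sentence : Formula → Set
Sentence φ = (free vx φ ≡ false) × (free vy φ ≡ false)

-- partial assignments (needed so that sentences can be evaluated on the
-- empty graph); atoms with an unassigned variable are false, which never
-- matters for sentences.
Assignment : Graph → Set
Assignment G = Var → Maybe (V G)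

update : ∀ {G} → Assignment G → Var → V G → Assignment G
update ρ z w a = if a ==V z then just w else ρ a

emptyA : ∀ {G} → Assignment G
emptyA _ = nothing

eval : (G : Graph) → Formula → Assignment G → Bool
eval G (eqF a b) ρ with ρ a | ρ b
... | just u | just v = ⌊ u ≟ v ⌋
... | _      | _      = false
eval G (edgeF a b) ρ with ρ a | ρ b
... | just u | just v = E G u v
... | _      | _      = false
eval G (negF φ) ρ     = not (eval G φ ρ)
eval G (andF φ ψ) ρ   = eval G φ ρ ∧ eval G ψ ρ
eval G (cntF t z φ) ρ = t ≤ᵇ countB (λ w → eval G φ (update {G} ρ z w))

C2Equiv : Graph → Graph → Set
C2Equiv G H = ∀ φ → Sentence φ → eval G φ (emptyA {G}) ≡ eval H φ (emptyA {H})

record Partition (G : Graph) : Set where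
  field
    k     : ℕ
    cls   : V G → Fin k
    onto  : ∀ c → ∃[ u ] cls u ≡ c

open Partition public

degIn : (G : Graph) (Π : Partition G) → V G → Fin (k Π) → ℕ
degIn G Π u c = countB (λ w → E G u w ∧ ⌊ cls Π w ≟ c ⌋)

Equitable : (G : Graph) → Partition G → Set
Equitable G Π = ∀ u v → cls Π u ≡ cls Π v → ∀ c → degIn G Π u c ≡ degIn G Π v c

Refines : {G : Graph} → Partition G → Partition G → Set
Refines Π' Π = ∀ u v → cls Π' u ≡ cls Π' v → cls Π u ≡ cls Π v

IsCoarsestEquitable : (G : Graph) → Partition G → Set
IsCoarsestEquitable G Π = Equitable G Π × (∀ Π' → Equitable G Π' → Refines Π' Π)

IsAutomorphism : (G : Graph) → Permutation′ (n G) → Set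
IsAutomorphism G σ = ∀ u v → E G (σ ⟨$⟩ʳ u) (σ ⟨$⟩ʳ v) ≡ E G u v

iterate : ∀ {m} → Permutation′ m → ℕ → Fin m → Fin m
iterate σ zero    u = u
iterate σ (suc j) u = σ ⟨$⟩ʳ iterate σ j u

-- the cycles of σ (= its orbits, fixed points included) are exactly the
-- classes of Π
CyclesAre : (G : Graph) → Permutation′ (n G) → Partition G → Set
CyclesAre G σ Π = ∀ u v → (cls Π u ≡ cls Π v → ∃[ j ] iterate σ j u ≡ v)
                        × (∃[ j ] iterate σ j u ≡ v → cls Π u ≡ cls Π v)

MultiCirculant : (G : Graph) → Partition G → Set
MultiCirculant G Π = Σ (Permutation′ (n G)) λ σ → IsAutomorphism G σ × CyclesAre G σ Π

module Submission where

-- Colour refinement on G stabilises at its coarsest equitable partition; the class sizes nᵢ and class degrees dᵢⱼ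
-- satisfy nᵢ dᵢⱼ = nⱼ dⱼᵢ, dᵢᵢ < nᵢ and 2 ∣ nᵢ dᵢᵢ. C² sees nothing but these parameters, so every graph with an
-- equitable partition carrying them is C²-equivalent to G. Such a graph H lives on disjoint cycles ℤ/nᵢ: inside a
-- class a circulant graph of degree dᵢᵢ, and between classes i and j, with g = gcd(nᵢ, nⱼ) and dᵢⱼ = t nⱼ/g, the
-- edges x ~ y with (y − x) mod g < t. Rotating all cycles by one step is an automorphism whose cycles are the classes,
-- and these classes form the coarsest equitable partition of H because the colours of colour refinement are
-- C²-definable.

open import Defs renaming (sym to edge-sym)
open import Data.Bool using (Bool; true; false; if_then_else_; _∧_; _∨_; not; T)
import Data.Bool as Bool
open import Data.Bool.Properties using (∧-assoc; ∧-comm; ∧-zeroʳ; ∧-identityʳ; ∨-assoc; ∨-comm; ∧-distribˡ-∨)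
open import Data.Empty using (⊥; ⊥-elim)
open import Data.Fin using (Fin; zero; suc; _≟_; toℕ; fromℕ<; _↑ˡ_; _↑ʳ_; splitAt) renaming (_<_ to _<ᶠ_)
open import Data.Fin.Properties using (any?; toℕ-fromℕ<; toℕ-injective; toℕ<n; splitAt-↑ˡ; splitAt-↑ʳ; splitAt⁻¹-↑ˡ; splitAt⁻¹-↑ʳ)
import Data.Fin.Properties as Fin
open import Data.Fin.Permutation using (Permutation′; permutation)
open import Data.Maybe using (Maybe; just; nothing)
import Data.Maybe as Maybe
open import Data.Maybe.Properties using (just-injective)
open import Data.Nat using (ℕ; zero; suc; _+_; _*_; _∸_; _≤_; _<_; z≤n; s≤s; z<s; _≤ᵇ_; _<ᵇ_; _≡ᵇ_; _%_; _/_; NonZero; ≢-nonZero)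
open import Data.Nat.Properties hiding (_≟_)
open import Algebra.Properties.CommutativeMonoid.Sum +-0-commutativeMonoid using (sum; sum-cong-≗; ∑-distrib-+; ∑-comm; sum-replicate-zero)
open import Data.Nat.DivMod
open import Data.Nat.Divisibility using (_∣_; divides)
open import Data.Nat.GCD
open import Data.Nat.Coprimality using (Coprime; coprime-/gcd; coprime-divisor)
import Data.Nat.Coprimality as Coprime
open import Data.Nat.Tactic.RingSolver using (solve-∀)
open import Data.Product using (Σ; _×_; _,_; ∃-syntax; proj₁; proj₂)
open import Data.Sum using (_⊎_; inj₁; inj₂)
open import Function using (_∘_)
open import Relation.Binary.Definitions using (Tri; tri<; tri≈; tri>)
open import Relation.Binary.PropositionalEquality using (_≡_; refl; sym; trans; cong; cong₂; subst; module ≡-Reasoning)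
open import Relation.Nullary using (yes; no; ¬_; Dec)
open import Relation.Nullary.Decidable using (⌊_⌋)


infixr 5 _∙_
_∙_ : ∀ {A : Set} {x y z : A} → x ≡ y → y ≡ z → x ≡ z
_∙_ = trans

[_] : Bool → ℕ
[ b ] = if b then 1 else 0

_=ᵇ_ : ∀ {k} → Fin k → Fin k → Bool
a =ᵇ b = ⌊ a ≟ b ⌋

=ᵇ-refl : ∀ {k} (a : Fin k) → (a =ᵇ a) ≡ true
=ᵇ-refl a with a ≟ a
... | yes _ = refl
... | no a≢a = ⊥-elim (a≢a refl)

=ᵇ⇒≡ : ∀ {k} {a b : Fin k} → (a =ᵇ b) ≡ true → a ≡ b
=ᵇ⇒≡ {a = a} {b} _ with a ≟ b
=ᵇ⇒≡ _ | yes a≡b = a≡b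

=ᵇ-sym : ∀ {k} (a b : Fin k) → (a =ᵇ b) ≡ (b =ᵇ a)
=ᵇ-sym a b with a ≟ b | b ≟ a
... | yes _   | yes _   = refl
... | no _    | no _    = refl
... | yes a≡b | no b≢a  = ⊥-elim (b≢a (sym a≡b))
... | no a≢b  | yes b≡a = ⊥-elim (a≢b (sym b≡a))

suc=ᵇsuc : ∀ {k} (a b : Fin k) → (suc a =ᵇ suc b) ≡ (a =ᵇ b)
suc=ᵇsuc a b with a ≟ b
... | yes _ = refl
... | no _  = refl

∧-true : ∀ {a b} → a ∧ b ≡ true → a ≡ true × b ≡ true
∧-true {true} {true} _ = refl , refl

∧-false : ∀ a b → (a ≡ true → b ≡ true → ⊥) → a ∧ b ≡ false
∧-false false b _ = refl
∧-false true false _ = refl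
∧-false true true contra = ⊥-elim (contra refl refl)

countB-cong : ∀ {m} {f g : Fin m → Bool} → (∀ x → f x ≡ g x) → countB f ≡ countB g
countB-cong {zero} f≗g = refl
countB-cong {suc m} f≗g = cong₂ (λ b c → [ b ] + c) (f≗g zero) (countB-cong (f≗g ∘ suc))

countB≡sum : ∀ {m} (f : Fin m → Bool) → countB f ≡ sum (λ x → [ f x ])
countB≡sum {zero} f = refl
countB≡sum {suc m} f = cong ([ f zero ] +_) (countB≡sum (f ∘ suc))

countB-const : ∀ m b → countB {m} (λ _ → b) ≡ (if b then m else 0)
countB-const zero false = refl
countB-const zero true = refl
countB-const (suc m) false = countB-const m false
countB-const (suc m) true = cong suc (countB-const m true)

countB-false : ∀ {m} (f : Fin m → Bool) → (∀ x → f x ≡ false) → countB f ≡ 0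
countB-false {m} f f≗false = countB-cong f≗false ∙ countB-const m false

countB-∧ˡ : ∀ {m} b (f : Fin m → Bool) → countB (λ x → b ∧ f x) ≡ (if b then countB f else 0)
countB-∧ˡ {m} false f = countB-const m false
countB-∧ˡ true f = refl

countB-∧ʳ : ∀ {m} (f : Fin m → Bool) b → countB (λ x → f x ∧ b) ≡ (if b then countB f else 0)
countB-∧ʳ f b = countB-cong (λ x → ∧-comm (f x) b) ∙ countB-∧ˡ b f

countB-split : ∀ {m} (f p : Fin m → Bool) →
  countB f ≡ countB (λ x → f x ∧ p x) + countB (λ x → f x ∧ not (p x))
countB-split {zero} f p = refl
countB-split {suc m} f p rewrite countB-split (f ∘ suc) (p ∘ suc) with f zero | p zero
... | false | _     = refl
... | true  | true  = refl
... | true  | false = sym (+-suc _ _)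

countB-mono : ∀ {m} (f g : Fin m → Bool) → (∀ x → f x ≡ true → g x ≡ true) → countB f ≤ countB g
countB-mono {zero} f g f⇒g = z≤n
countB-mono {suc m} f g f⇒g with f zero in f₀ | g zero in g₀
... | false | false = countB-mono (f ∘ suc) (g ∘ suc) (f⇒g ∘ suc)
... | false | true  = m≤n⇒m≤1+n (countB-mono (f ∘ suc) (g ∘ suc) (f⇒g ∘ suc))
... | true  | true  = s≤s (countB-mono (f ∘ suc) (g ∘ suc) (f⇒g ∘ suc))
... | true  | false with () ← sym g₀ ∙ f⇒g zero f₀

countB-mono-< : ∀ {m} (f g : Fin m → Bool) → (∀ x → f x ≡ true → g x ≡ true) →
  ∀ y → f y ≡ false → g y ≡ true → countB f < countB g
countB-mono-< {suc m} f g f⇒g zero fy gy rewrite fy | gy = s≤s (countB-mono (f ∘ suc) (g ∘ suc) (f⇒g ∘ suc))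
countB-mono-< {suc m} f g f⇒g (suc y) fy gy with f zero in f₀ | g zero in g₀
... | false | false = countB-mono-< (f ∘ suc) (g ∘ suc) (f⇒g ∘ suc) y fy gy
... | false | true  = m≤n⇒m≤1+n (countB-mono-< (f ∘ suc) (g ∘ suc) (f⇒g ∘ suc) y fy gy)
... | true  | true  = s≤s (countB-mono-< (f ∘ suc) (g ∘ suc) (f⇒g ∘ suc) y fy gy)
... | true  | false with () ← sym g₀ ∙ f⇒g zero f₀

countB-point : ∀ {m} (u : Fin m) (f : Fin m → Bool) → countB (λ x → (u =ᵇ x) ∧ f x) ≡ [ f u ]
countB-point {suc m} zero f = cong ([ f zero ] +_) (countB-const m false) ∙ +-identityʳ _
countB-point {suc m} (suc u) f = countB-cong (λ x → cong (_∧ f (suc x)) (suc=ᵇsuc u x)) ∙ countB-point u (f ∘ suc)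

sum-point : ∀ {k} (a : Fin k) (F : Fin k → ℕ) → sum (λ c → if a =ᵇ c then F c else 0) ≡ F a
sum-point {suc k} zero F = cong (F zero +_) (sum-replicate-zero k) ∙ +-identityʳ _
sum-point {suc k} (suc a) F = sum-cong-≗ (λ c → cong (λ b → if b then F (suc c) else 0) (suc=ᵇsuc a c)) ∙ sum-point a (F ∘ suc)

sum-indicator : ∀ {k} (p : Fin k → Bool) (d : ℕ) → sum (λ u → if p u then d else 0) ≡ countB p * d
sum-indicator {zero} p d = refl
sum-indicator {suc k} p d rewrite sum-indicator (p ∘ suc) d with p zero
... | false = refl
... | true  = refl

[∧] : ∀ b c → [ b ∧ c ] ≡ (if c then [ b ] else 0)
[∧] false false = refl
[∧] false true  = refl
[∧] true  false = refl
[∧] true  true  = refl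

countB-partition : ∀ {m k} (cl : Fin m → Fin k) (f : Fin m → Bool) →
  countB f ≡ sum (λ c → countB (λ x → f x ∧ (cl x =ᵇ c)))
countB-partition {m} {k} cl f = begin
  countB f                                                 ≡⟨ countB≡sum f ⟩
  sum (λ x → [ f x ])                                      ≡⟨ sum-cong-≗ (λ x → sym (sum-point (cl x) (λ _ → [ f x ]))) ⟩
  sum (λ x → sum (λ c → if cl x =ᵇ c then [ f x ] else 0))
    ≡⟨ sum-cong-≗ (λ x → sum-cong-≗ (λ c → sym ([∧] (f x) (cl x =ᵇ c)))) ⟩
  sum (λ x → sum (λ c → [ f x ∧ (cl x =ᵇ c) ]))            ≡⟨ ∑-comm {m} {k} (λ x c → [ f x ∧ (cl x =ᵇ c) ]) ⟩
  sum (λ c → sum (λ x → [ f x ∧ (cl x =ᵇ c) ]))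
    ≡⟨ sum-cong-≗ (λ c → sym (countB≡sum (λ x → f x ∧ (cl x =ᵇ c)))) ⟩
  sum (λ c → countB (λ x → f x ∧ (cl x =ᵇ c)))             ∎
  where open ≡-Reasoning

countB-swap : ∀ {m k} (f : Fin m → Fin k → Bool) →
  sum (λ u → countB (f u)) ≡ sum (λ v → countB (λ u → f u v))
countB-swap {m} {k} f = sum-cong-≗ (λ u → countB≡sum (f u))
              ∙ ∑-comm {m} {k} (λ u v → [ f u v ])
              ∙ sym (sum-cong-≗ (λ v → countB≡sum (λ u → f u v)))

-- Peeling off the first vertex counts each of its edges once in its row and once in its column.
handshake : ∀ {m} (M : Fin m → Fin m → Bool) → (∀ u v → M u v ≡ M v u) → (∀ u → M u u ≡ false) →
  ∃[ e ] sum (λ u → countB (M u)) ≡ e + e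
handshake {zero} M M-sym M-irrefl = 0 , refl
handshake {suc m} M M-sym M-irrefl
  with handshake (λ u v → M (suc u) (suc v)) (λ u v → M-sym (suc u) (suc v)) (M-irrefl ∘ suc)
... | e , rest = row + e , (begin
  [ M zero zero ] + row + sum (λ u → [ M (suc u) zero ] + countB (λ v → M (suc u) (suc v)))
    ≡⟨ cong₂ (λ a b → [ a ] + row + b) (M-irrefl zero) (∑-distrib-+ (λ u → [ M (suc u) zero ]) _) ⟩
  row + (sum (λ u → [ M (suc u) zero ]) + sum (λ u → countB (λ v → M (suc u) (suc v))))
    ≡⟨ cong₂ (λ a b → row + (a + b)) column rest ⟩
  row + (row + (e + e))
    ≡⟨ regroup row e ⟩
  (row + e) + (row + e) ∎)
  where
  open ≡-Reasoning
  row = countB (M zero ∘ suc)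
  regroup : ∀ r e → r + (r + (e + e)) ≡ (r + e) + (r + e)
  regroup = solve-∀
  column : sum (λ u → [ M (suc u) zero ]) ≡ row
  column = sum-cong-≗ (λ u → cong [_] (M-sym (suc u) zero)) ∙ sym (countB≡sum (M zero ∘ suc))

countB-∧≤ : ∀ {m} (p q : Fin m → Bool) → countB (λ x → p x ∧ q x) ≤ countB q
countB-∧≤ p q = countB-mono _ q (λ x → proj₂ ∘ ∧-true {p x})

countB-∧-const : ∀ {m} (p q : Fin m → Bool) b → (∀ x → q x ≡ true → p x ≡ b) →
  countB (λ x → p x ∧ q x) ≡ (if b then countB q else 0)
countB-∧-const p q b p≡b = countB-cong pointwise ∙ countB-∧ˡ b q
  where
  pointwise : ∀ x → p x ∧ q x ≡ b ∧ q x
  pointwise x with q x in qx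
  ... | true  = cong (_∧ true) (p≡b x qx)
  ... | false = ∧-zeroʳ (p x) ∙ sym (∧-zeroʳ b)

¬∃true⇒false : ∀ {m} (q : Fin m → Bool) → ¬ (∃[ x ] q x ≡ true) → ∀ x → q x ≡ false
¬∃true⇒false q none x with q x in qx
... | true  = ⊥-elim (none (x , qx))
... | false = refl

countB-∧-uniform : ∀ {m₁ m₂} (p₁ q₁ : Fin m₁ → Bool) (p₂ q₂ : Fin m₂ → Bool) → countB q₁ ≡ countB q₂ →
  (∀ x y → q₁ x ≡ true → q₂ y ≡ true → p₁ x ≡ p₂ y) →
  countB (λ x → p₁ x ∧ q₁ x) ≡ countB (λ y → p₂ y ∧ q₂ y)
countB-∧-uniform p₁ q₁ p₂ q₂ same uniform
  with any? (λ x → q₁ x Bool.≟ true) | any? (λ y → q₂ y Bool.≟ true)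
... | yes (x₀ , q₁x₀) | yes (y₀ , q₂y₀) =
  countB-∧-const p₁ q₁ (p₁ x₀) (λ x q₁x → uniform x y₀ q₁x q₂y₀ ∙ sym (uniform x₀ y₀ q₁x₀ q₂y₀))
  ∙ cong (λ n → if p₁ x₀ then n else 0) same
  ∙ sym (countB-∧-const p₂ q₂ (p₁ x₀) (λ y q₂y → sym (uniform x₀ y q₁x₀ q₂y)))
... | _ | no none₂ = n≤0⇒n≡0 (≤-trans (countB-∧≤ p₁ q₁) (≤-reflexive (same ∙ empty₂)))
                   ∙ sym (n≤0⇒n≡0 (≤-trans (countB-∧≤ p₂ q₂) (≤-reflexive empty₂)))
  where empty₂ = countB-false q₂ (¬∃true⇒false q₂ none₂)
... | no none₁ | _ = n≤0⇒n≡0 (≤-trans (countB-∧≤ p₁ q₁) (≤-reflexive empty₁))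
                   ∙ sym (n≤0⇒n≡0 (≤-trans (countB-∧≤ p₂ q₂) (≤-reflexive (sym same ∙ empty₁))))
  where empty₁ = countB-false q₁ (¬∃true⇒false q₁ none₁)

literal : Bool → Bool → Bool
literal true  b = b
literal false b = not b

literal-false : ∀ polarity → literal polarity false ≡ not polarity
literal-false true  = refl
literal-false false = refl

literal-true : ∀ polarity b → literal polarity b ≡ true → b ≡ polarity
literal-true true  true  _ = refl
literal-true false false _ = refl

Σ𝔹² : (Bool → Bool → ℕ) → ℕ
Σ𝔹² F = (F true true + F true false) + (F false true + F false false)

Σ𝔹²-cong : ∀ {F F′} → (∀ a b → F a b ≡ F′ a b) → Σ𝔹² F ≡ Σ𝔹² F′
Σ𝔹²-cong F≗F′ =
  cong₂ _+_ (cong₂ _+_ (F≗F′ true true) (F≗F′ true false)) (cong₂ _+_ (F≗F′ false true) (F≗F′ false false))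

Σ𝔹²-cancel : ∀ {F F′} → Σ𝔹² F ≡ Σ𝔹² F′ →
  F true true ≡ F′ true true → F true false ≡ F′ true false → F false true ≡ F′ false true →
  F false false ≡ F′ false false
Σ𝔹²-cancel {F} {F′} total tt tf ft rewrite tt | tf | ft =
  +-cancelˡ-≡ (F′ false true) _ _ (+-cancelˡ-≡ (F′ true true + F′ true false) _ _ total)

countB-literals : ∀ {m} (f p q : Fin m → Bool) →
  countB f ≡ Σ𝔹² (λ a b → countB (λ x → (f x ∧ literal a (p x)) ∧ literal b (q x)))
countB-literals f p q = countB-split f p ∙ cong₂ _+_ (countB-split _ q) (countB-split _ q)

sum-mono-≤ : ∀ {m} (f g : Fin m → ℕ) → (∀ x → f x ≤ g x) → sum f ≤ sum g
sum-mono-≤ {zero} f g f≤g = z≤n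
sum-mono-≤ {suc m} f g f≤g = +-mono-≤ (f≤g zero) (sum-mono-≤ (f ∘ suc) (g ∘ suc) (f≤g ∘ suc))

sum-mono-< : ∀ {m} (f g : Fin m → ℕ) → (∀ x → f x ≤ g x) → ∀ y → f y < g y → sum f < sum g
sum-mono-< {suc m} f g f≤g zero fy<gy = +-mono-<-≤ fy<gy (sum-mono-≤ (f ∘ suc) (g ∘ suc) (f≤g ∘ suc))
sum-mono-< {suc m} f g f≤g (suc y) fy<gy = +-mono-≤-< (f≤g zero) (sum-mono-< (f ∘ suc) (g ∘ suc) (f≤g ∘ suc) y fy<gy)

allᶠ : ∀ {m} → (Fin m → Bool) → Bool
allᶠ {zero} f = true
allᶠ {suc m} f = f zero ∧ allᶠ (f ∘ suc)

allᶠ-true : ∀ {m} (f : Fin m → Bool) → allᶠ f ≡ true → ∀ x → f x ≡ true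
allᶠ-true {suc m} f all x with f zero in f₀
allᶠ-true {suc m} f all zero    | true = f₀
allᶠ-true {suc m} f all (suc x) | true = allᶠ-true (f ∘ suc) all x

allᶠ-intro : ∀ {m} (f : Fin m → Bool) → (∀ x → f x ≡ true) → allᶠ f ≡ true
allᶠ-intro {zero} f all = refl
allᶠ-intro {suc m} f all rewrite all zero = allᶠ-intro (f ∘ suc) (all ∘ suc)

allᶠ-cong : ∀ {m} {f g : Fin m → Bool} → (∀ x → f x ≡ g x) → allᶠ f ≡ allᶠ g
allᶠ-cong {zero} f≗g = refl
allᶠ-cong {suc m} f≗g = cong₂ _∧_ (f≗g zero) (allᶠ-cong (f≗g ∘ suc))

-- C² only sees class sizes and class degrees

eqᴹ : ∀ {m} → Maybe (Fin m) → Maybe (Fin m) → Bool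
eqᴹ (just u) (just v) = u =ᵇ v
eqᴹ _        _        = false

edgeᴹ : (G : Graph) → Maybe (V G) → Maybe (V G) → Bool
edgeᴹ G (just u) (just v) = E G u v
edgeᴹ G _        _        = false

eval-eqF : ∀ G a b ρ → eval G (eqF a b) ρ ≡ eqᴹ (ρ a) (ρ b)
eval-eqF G a b ρ with ρ a | ρ b
... | just u  | just v  = refl
... | just u  | nothing = refl
... | nothing | _       = refl

eval-edgeF : ∀ G a b ρ → eval G (edgeF a b) ρ ≡ edgeᴹ G (ρ a) (ρ b)
eval-edgeF G a b ρ with ρ a | ρ b
... | just u  | just v  = refl
... | just u  | nothing = refl
... | nothing | _       = refl

eqᴹ-sym : ∀ {m} (o o′ : Maybe (Fin m)) → eqᴹ o o′ ≡ eqᴹ o′ o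
eqᴹ-sym (just u) (just v) = =ᵇ-sym u v
eqᴹ-sym (just u) nothing  = refl
eqᴹ-sym nothing  (just v) = refl
eqᴹ-sym nothing  nothing  = refl

edgeᴹ-sym : ∀ G (o o′ : Maybe (V G)) → edgeᴹ G o o′ ≡ edgeᴹ G o′ o
edgeᴹ-sym G (just u) (just v) = edge-sym G u v
edgeᴹ-sym G (just u) nothing  = refl
edgeᴹ-sym G nothing  (just v) = refl
edgeᴹ-sym G nothing  nothing  = refl

other : Var → Var
other vx = vy
other vy = vx

-- o is the value of the other variable while a counting quantifier ranges over x.
cell : (G : Graph) {k : ℕ} → (V G → Fin k) → Maybe (V G) → Fin k → Bool → Bool → V G → Bool
cell G cl o c equal adjacent x = ((cl x =ᵇ c) ∧ literal equal (eqᴹ o (just x))) ∧ literal adjacent (edgeᴹ G o (just x))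

classSize : (G : Graph) {k : ℕ} → (V G → Fin k) → Fin k → ℕ
classSize G cl c = countB (λ x → cl x =ᵇ c)

classDegree : (G : Graph) {k : ℕ} → (V G → Fin k) → V G → Fin k → ℕ
classDegree G cl u c = countB (λ w → E G u w ∧ (cl w =ᵇ c))

module _ (G : Graph) {k : ℕ} (cl : V G → Fin k) (c : Fin k) where

  countB-cell-nothing : ∀ equal adjacent → countB (cell G cl nothing c equal adjacent)
    ≡ (if not adjacent then (if not equal then classSize G cl c else 0) else 0)
  countB-cell-nothing equal adjacent =
    countB-cong (λ x → cong₂ (λ e a → ((cl x =ᵇ c) ∧ e) ∧ a) (literal-false equal) (literal-false adjacent))
    ∙ countB-∧ʳ (λ x → (cl x =ᵇ c) ∧ not equal) (not adjacent)
    ∙ cong (λ n → if not adjacent then n else 0) (countB-∧ʳ (λ x → cl x =ᵇ c) (not equal))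

  countB-cell-loop : ∀ u → countB (cell G cl (just u) c true true) ≡ 0
  countB-cell-loop u = countB-false _ no-loop
    where
    no-loop : ∀ x → cell G cl (just u) c true true x ≡ false
    no-loop x with u =ᵇ x in u=x
    ... | false = cong (_∧ E G u x) (∧-zeroʳ _)
    ... | true rewrite =ᵇ⇒≡ u=x | loopless G x = ∧-zeroʳ _

  countB-cell-self : ∀ u → countB (cell G cl (just u) c true false) ≡ [ cl u =ᵇ c ]
  countB-cell-self u =
    countB-cong (λ x → cong (_∧ not (E G u x)) (∧-comm (cl x =ᵇ c) (u =ᵇ x)) ∙ ∧-assoc (u =ᵇ x) _ _)
    ∙ countB-point u (λ x → (cl x =ᵇ c) ∧ not (E G u x))
    ∙ cong (λ b → [ (cl u =ᵇ c) ∧ not b ]) (loopless G u) ∙ cong [_] (∧-identityʳ _)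

  countB-cell-neighbour : ∀ u → countB (cell G cl (just u) c false true) ≡ classDegree G cl u c
  countB-cell-neighbour u = countB-cong neighbour
    where
    neighbour : ∀ x → cell G cl (just u) c false true x ≡ E G u x ∧ (cl x =ᵇ c)
    neighbour x with u =ᵇ x in u=x
    ... | false = cong (_∧ E G u x) (∧-identityʳ _) ∙ ∧-comm _ (E G u x)
    ... | true rewrite =ᵇ⇒≡ u=x | loopless G x = ∧-zeroʳ _

  classSize-cells : ∀ o → classSize G cl c ≡ Σ𝔹² (λ equal adjacent → countB (cell G cl o c equal adjacent))
  classSize-cells o = countB-literals (λ x → cl x =ᵇ c) (λ x → eqᴹ o (just x)) (λ x → edgeᴹ G o (just x))

cell-true : ∀ (G : Graph) {k} (cl : V G → Fin k) o c equal adjacent x → cell G cl o c equal adjacent x ≡ true →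
  (cl x ≡ c × eqᴹ o (just x) ≡ equal) × edgeᴹ G o (just x) ≡ adjacent
cell-true G cl o c equal adjacent x holds with ∧-true {(cl x =ᵇ c) ∧ literal equal (eqᴹ o (just x))} holds
... | class-equal , adjacent′ with ∧-true {cl x =ᵇ c} class-equal
... | class , equal′ = (=ᵇ⇒≡ class , literal-true equal _ equal′) , literal-true adjacent _ adjacent′

assignX : (G : Graph) → V G → Assignment G
assignX G u = update {G} (emptyA {G}) vx u

module Transfer (G₁ G₂ : Graph) {k : ℕ} (cl₁ : V G₁ → Fin k) (cl₂ : V G₂ → Fin k)
  (same-size : ∀ c → classSize G₁ cl₁ c ≡ classSize G₂ cl₂ c)
  (same-degree : ∀ u₁ u₂ → cl₁ u₁ ≡ cl₂ u₂ → ∀ c → classDegree G₁ cl₁ u₁ c ≡ classDegree G₂ cl₂ u₂ c) where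

  record Matched (ρ₁ : Assignment G₁) (ρ₂ : Assignment G₂) : Set where
    field
      same-class : ∀ a → Maybe.map cl₁ (ρ₁ a) ≡ Maybe.map cl₂ (ρ₂ a)
      same-eq    : ∀ a b → eqᴹ (ρ₁ a) (ρ₁ b) ≡ eqᴹ (ρ₂ a) (ρ₂ b)
      same-edge  : ∀ a b → edgeᴹ G₁ (ρ₁ a) (ρ₁ b) ≡ edgeᴹ G₂ (ρ₂ a) (ρ₂ b)
  open Matched

  Matched-update : ∀ {ρ₁ ρ₂} z {x₁ x₂} → Matched ρ₁ ρ₂ → cl₁ x₁ ≡ cl₂ x₂ →
    eqᴹ (ρ₁ (other z)) (just x₁) ≡ eqᴹ (ρ₂ (other z)) (just x₂) →
    edgeᴹ G₁ (ρ₁ (other z)) (just x₁) ≡ edgeᴹ G₂ (ρ₂ (other z)) (just x₂) →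
    Matched (update {G₁} ρ₁ z x₁) (update {G₂} ρ₂ z x₂)
  Matched-update {ρ₁} {ρ₂} vx {x₁} {x₂} m class eq edge = record
    { same-class = λ { vx → cong just class ; vy → same-class m vy }
    ; same-eq    = λ { vx vx → =ᵇ-refl x₁ ∙ sym (=ᵇ-refl x₂)
                     ; vx vy → eqᴹ-sym (just x₁) (ρ₁ vy) ∙ eq ∙ eqᴹ-sym (ρ₂ vy) (just x₂)
                     ; vy vx → eq
                     ; vy vy → same-eq m vy vy }
    ; same-edge  = λ { vx vx → loopless G₁ x₁ ∙ sym (loopless G₂ x₂)
                     ; vx vy → edgeᴹ-sym G₁ (just x₁) (ρ₁ vy) ∙ edge ∙ edgeᴹ-sym G₂ (ρ₂ vy) (just x₂)
                     ; vy vx → edge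
                     ; vy vy → same-edge m vy vy } }
  Matched-update {ρ₁} {ρ₂} vy {x₁} {x₂} m class eq edge = record
    { same-class = λ { vx → same-class m vx ; vy → cong just class }
    ; same-eq    = λ { vx vx → same-eq m vx vx
                     ; vx vy → eq
                     ; vy vx → eqᴹ-sym (just x₁) (ρ₁ vx) ∙ eq ∙ eqᴹ-sym (ρ₂ vx) (just x₂)
                     ; vy vy → =ᵇ-refl x₁ ∙ sym (=ᵇ-refl x₂) }
    ; same-edge  = λ { vx vx → same-edge m vx vx
                     ; vx vy → edge
                     ; vy vx → edgeᴹ-sym G₁ (just x₁) (ρ₁ vx) ∙ edge ∙ edgeᴹ-sym G₂ (ρ₂ vx) (just x₂)
                     ; vy vy → loopless G₁ x₁ ∙ sym (loopless G₂ x₂) } }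

  same-cell-size : ∀ (o₁ : Maybe (V G₁)) (o₂ : Maybe (V G₂)) → Maybe.map cl₁ o₁ ≡ Maybe.map cl₂ o₂ →
    ∀ c equal adjacent → countB (cell G₁ cl₁ o₁ c equal adjacent) ≡ countB (cell G₂ cl₂ o₂ c equal adjacent)
  same-cell-size nothing nothing _ c equal adjacent =
    countB-cell-nothing G₁ cl₁ c equal adjacent
    ∙ cong (λ n → if not adjacent then (if not equal then n else 0) else 0) (same-size c)
    ∙ sym (countB-cell-nothing G₂ cl₂ c equal adjacent)
  same-cell-size (just u₁) (just u₂) same-u c = cells
    where
    class : cl₁ u₁ ≡ cl₂ u₂
    class = just-injective same-u
    Cell₁ Cell₂ : Bool → Bool → ℕ
    Cell₁ equal adjacent = countB (cell G₁ cl₁ (just u₁) c equal adjacent)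
    Cell₂ equal adjacent = countB (cell G₂ cl₂ (just u₂) c equal adjacent)
    loop : Cell₁ true true ≡ Cell₂ true true
    loop = countB-cell-loop G₁ cl₁ c u₁ ∙ sym (countB-cell-loop G₂ cl₂ c u₂)
    self : Cell₁ true false ≡ Cell₂ true false
    self = countB-cell-self G₁ cl₁ c u₁ ∙ cong (λ a → [ a =ᵇ c ]) class ∙ sym (countB-cell-self G₂ cl₂ c u₂)
    neighbour : Cell₁ false true ≡ Cell₂ false true
    neighbour = countB-cell-neighbour G₁ cl₁ c u₁ ∙ same-degree u₁ u₂ class c ∙ sym (countB-cell-neighbour G₂ cl₂ c u₂)
    rest : Cell₁ false false ≡ Cell₂ false false
    rest = Σ𝔹²-cancel {Cell₁} {Cell₂}
      (sym (classSize-cells G₁ cl₁ c (just u₁)) ∙ same-size c ∙ classSize-cells G₂ cl₂ c (just u₂)) loop self neighbour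
    cells : ∀ equal adjacent → Cell₁ equal adjacent ≡ Cell₂ equal adjacent
    cells true  true  = loop
    cells true  false = self
    cells false true  = neighbour
    cells false false = rest

  count-extension : ∀ z φ {ρ₁ ρ₂} → Matched ρ₁ ρ₂ →
    (∀ {ρ₁′ ρ₂′} → Matched ρ₁′ ρ₂′ → eval G₁ φ ρ₁′ ≡ eval G₂ φ ρ₂′) →
    countB (λ w → eval G₁ φ (update {G₁} ρ₁ z w)) ≡ countB (λ w → eval G₂ φ (update {G₂} ρ₂ z w))
  count-extension z φ {ρ₁} {ρ₂} m same-eval =
    countB-partition cl₁ p₁
    ∙ sum-cong-≗ (λ c → countB-literals (λ x → p₁ x ∧ (cl₁ x =ᵇ c)) (λ x → eqᴹ o₁ (just x)) (λ x → edgeᴹ G₁ o₁ (just x))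
                        ∙ Σ𝔹²-cong (same-part c)
                        ∙ sym (countB-literals (λ x → p₂ x ∧ (cl₂ x =ᵇ c)) (λ x → eqᴹ o₂ (just x)) (λ x → edgeᴹ G₂ o₂ (just x))))
    ∙ sym (countB-partition cl₂ p₂)
    where
    p₁ : V G₁ → Bool
    p₁ w = eval G₁ φ (update {G₁} ρ₁ z w)
    p₂ : V G₂ → Bool
    p₂ w = eval G₂ φ (update {G₂} ρ₂ z w)
    o₁ : Maybe (V G₁)
    o₁ = ρ₁ (other z)
    o₂ : Maybe (V G₂)
    o₂ = ρ₂ (other z)
    reassoc : ∀ p a b c → ((p ∧ a) ∧ b) ∧ c ≡ p ∧ ((a ∧ b) ∧ c)
    reassoc p a b c = cong (_∧ c) (∧-assoc p a b) ∙ ∧-assoc p (a ∧ b) c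
    same-part : ∀ c equal adjacent →
      countB (λ x → ((p₁ x ∧ (cl₁ x =ᵇ c)) ∧ literal equal (eqᴹ o₁ (just x))) ∧ literal adjacent (edgeᴹ G₁ o₁ (just x)))
      ≡ countB (λ x → ((p₂ x ∧ (cl₂ x =ᵇ c)) ∧ literal equal (eqᴹ o₂ (just x))) ∧ literal adjacent (edgeᴹ G₂ o₂ (just x)))
    same-part c equal adjacent =
      countB-cong (λ x → reassoc (p₁ x) _ _ _)
      ∙ countB-∧-uniform p₁ (cell G₁ cl₁ o₁ c equal adjacent) p₂ (cell G₂ cl₂ o₂ c equal adjacent)
          (same-cell-size o₁ o₂ (same-class m (other z)) c equal adjacent) uniform
      ∙ sym (countB-cong (λ x → reassoc (p₂ x) _ _ _))
      where
      uniform : ∀ x₁ x₂ → cell G₁ cl₁ o₁ c equal adjacent x₁ ≡ true → cell G₂ cl₂ o₂ c equal adjacent x₂ ≡ true →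
        p₁ x₁ ≡ p₂ x₂
      uniform x₁ x₂ in₁ in₂
        with cell-true G₁ cl₁ o₁ c equal adjacent x₁ in₁ | cell-true G₂ cl₂ o₂ c equal adjacent x₂ in₂
      ... | (class₁ , equal₁) , adjacent₁ | (class₂ , equal₂) , adjacent₂ =
        same-eval (Matched-update z m (class₁ ∙ sym class₂) (equal₁ ∙ sym equal₂) (adjacent₁ ∙ sym adjacent₂))

  Matched⇒same-eval : ∀ φ {ρ₁ ρ₂} → Matched ρ₁ ρ₂ → eval G₁ φ ρ₁ ≡ eval G₂ φ ρ₂
  Matched⇒same-eval (eqF a b) {ρ₁} {ρ₂} m = eval-eqF G₁ a b ρ₁ ∙ same-eq m a b ∙ sym (eval-eqF G₂ a b ρ₂)
  Matched⇒same-eval (edgeF a b) {ρ₁} {ρ₂} m = eval-edgeF G₁ a b ρ₁ ∙ same-edge m a b ∙ sym (eval-edgeF G₂ a b ρ₂)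
  Matched⇒same-eval (negF φ) m = cong not (Matched⇒same-eval φ m)
  Matched⇒same-eval (andF φ ψ) m = cong₂ _∧_ (Matched⇒same-eval φ m) (Matched⇒same-eval ψ m)
  Matched⇒same-eval (cntF t z φ) m = cong (t ≤ᵇ_) (count-extension z φ m (Matched⇒same-eval φ))

  Matched-assignX : ∀ {u₁ u₂} → cl₁ u₁ ≡ cl₂ u₂ → Matched (assignX G₁ u₁) (assignX G₂ u₂)
  Matched-assignX {u₁} {u₂} class = record
    { same-class = λ { vx → cong just class ; vy → refl }
    ; same-eq    = λ { vx vx → =ᵇ-refl u₁ ∙ sym (=ᵇ-refl u₂) ; vx vy → refl ; vy vx → refl ; vy vy → refl }
    ; same-edge  = λ { vx vx → loopless G₁ u₁ ∙ sym (loopless G₂ u₂) ; vx vy → refl ; vy vx → refl ; vy vy → refl } }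

  C2-equivalent : C2Equiv G₁ G₂
  C2-equivalent φ _ = Matched⇒same-eval φ empty
    where
    empty : Matched (emptyA {G₁}) (emptyA {G₂})
    empty = record { same-class = λ _ → refl ; same-eq = λ _ _ → refl ; same-edge = λ _ _ → refl }

-- Colour refinement and the C² formulas defining its colours

≡ᵇ-refl : ∀ a → (a ≡ᵇ a) ≡ true
≡ᵇ-refl zero = refl
≡ᵇ-refl (suc a) = ≡ᵇ-refl a

≡ᵇ-true⇒≡ : ∀ a b → (a ≡ᵇ b) ≡ true → a ≡ b
≡ᵇ-true⇒≡ a b a≡ᵇb = ≡ᵇ⇒≡ a b (subst T (sym a≡ᵇb) _)

≡ᵇ-sym : ∀ a b → (a ≡ᵇ b) ≡ (b ≡ᵇ a)
≡ᵇ-sym zero zero = refl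
≡ᵇ-sym zero (suc b) = refl
≡ᵇ-sym (suc a) zero = refl
≡ᵇ-sym (suc a) (suc b) = ≡ᵇ-sym a b

at-least∧¬more≡exactly : ∀ c n → (c ≤ᵇ n) ∧ not (suc c ≤ᵇ n) ≡ (c ≡ᵇ n)
at-least∧¬more≡exactly zero zero = refl
at-least∧¬more≡exactly zero (suc n) = refl
at-least∧¬more≡exactly (suc c) zero = refl
at-least∧¬more≡exactly (suc zero) (suc n) = at-least∧¬more≡exactly zero n
at-least∧¬more≡exactly (suc (suc c)) (suc n) = at-least∧¬more≡exactly (suc c) n

trueF : Var → Formula
trueF z = eqF z z

exactlyF : ℕ → Var → Formula → Formula
exactlyF c z φ = andF (cntF c z φ) (negF (cntF (suc c) z φ))

allF : ∀ {m} → (Fin m → Formula) → Var → Formula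
allF {zero} φ z = trueF z
allF {suc m} φ z = andF (φ zero) (allF (φ ∘ suc) z)

module ColourRefinement (G : Graph) where

  sameColour : ℕ → V G → V G → Bool
  colourDegree : ℕ → V G → V G → ℕ
  sameColour zero u v = true
  sameColour (suc i) u v = sameColour i u v ∧ allᶠ (λ w → colourDegree i u w ≡ᵇ colourDegree i v w)
  colourDegree i u w = countB (λ y → E G u y ∧ sameColour i w y)

  sameColour-pred : ∀ i u v → sameColour (suc i) u v ≡ true → sameColour i u v ≡ true
  sameColour-pred i u v same = proj₁ (∧-true same)

  sameColour-suc⇒colourDegree : ∀ i u v → sameColour (suc i) u v ≡ true → ∀ w → colourDegree i u w ≡ colourDegree i v w
  sameColour-suc⇒colourDegree i u v same w = ≡ᵇ-true⇒≡ _ _ (allᶠ-true _ (proj₂ (∧-true same)) w)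

  sameColour-refl : ∀ i u → sameColour i u u ≡ true
  sameColour-refl zero u = refl
  sameColour-refl (suc i) u = cong₂ _∧_ (sameColour-refl i u) (allᶠ-intro _ (λ w → ≡ᵇ-refl (colourDegree i u w)))

  sameColour-sym : ∀ i u v → sameColour i u v ≡ sameColour i v u
  sameColour-sym zero u v = refl
  sameColour-sym (suc i) u v = cong₂ _∧_ (sameColour-sym i u v) (allᶠ-cong (λ w → ≡ᵇ-sym (colourDegree i u w) (colourDegree i v w)))

  sameColour-trans : ∀ i u v w → sameColour i u v ≡ true → sameColour i v w ≡ true → sameColour i u w ≡ true
  sameColour-trans zero u v w _ _ = refl
  sameColour-trans (suc i) u v w uv vw = cong₂ _∧_
    (sameColour-trans i u v w (sameColour-pred i u v uv) (sameColour-pred i v w vw))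
    (allᶠ-intro _ (λ x → cong (colourDegree i u x ≡ᵇ_)
                              (sym (sameColour-suc⇒colourDegree i u v uv x ∙ sameColour-suc⇒colourDegree i v w vw x))
                         ∙ ≡ᵇ-refl (colourDegree i u x)))

  sameColourPairs : ℕ → ℕ
  sameColourPairs i = sum (λ u → countB (sameColour i u))

  Splits : ℕ → V G → V G → Set
  Splits i u v = sameColour i u v ≡ true × sameColour (suc i) u v ≡ false

  splits? : ∀ i u v → Dec (Splits i u v)
  splits? i u v with sameColour i u v Bool.≟ true | sameColour (suc i) u v Bool.≟ false
  ... | yes same | yes split = yes (same , split)
  ... | no ¬same | _         = no (¬same ∘ proj₁)
  ... | _        | no ¬split = no (¬split ∘ proj₂)

  ¬Splits⇒stable : ∀ i → ¬ (∃[ u ] ∃[ v ] Splits i u v) → ∀ u v → sameColour (suc i) u v ≡ sameColour i u v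
  ¬Splits⇒stable i none u v = stays (sameColour i u v) _ (λ same split → none (u , v , same , cong₂ _∧_ same split))
    where
    stays : ∀ a b → (a ≡ true → b ≡ false → ⊥) → a ∧ b ≡ a
    stays false b _ = refl
    stays true true _ = refl
    stays true false contra = ⊥-elim (contra refl refl)

  Splits⇒fewer-pairs : ∀ i u v → Splits i u v → sameColourPairs (suc i) < sameColourPairs i
  Splits⇒fewer-pairs i u v (same , split) =
    sum-mono-< _ _ (λ x → countB-mono _ _ (sameColour-pred i x)) u (countB-mono-< _ _ (sameColour-pred i u) v split same)

  -- Each round that changes anything splits a pair, so the number of same-coloured pairs bounds the rounds.
  stabilises : ∀ fuel i → sameColourPairs i ≤ fuel → ∃[ j ] ∀ u v → sameColour (suc j) u v ≡ sameColour j u v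
  stabilises fuel i pairs≤fuel with any? (λ u → any? (λ v → splits? i u v))
  ... | no none = i , ¬Splits⇒stable i (λ { (u , v , s) → none (u , v , s) })
  stabilises zero i pairs≤fuel | yes (u , v , s) with () ← ≤-trans (Splits⇒fewer-pairs i u v s) pairs≤fuel
  stabilises (suc fuel) i pairs≤fuel | yes (u , v , s) =
    stabilises fuel (suc i) (≤-pred (≤-trans (Splits⇒fewer-pairs i u v s) pairs≤fuel))

  colourF : ℕ → V G → Var → Formula
  colourF zero u z = trueF z
  colourF (suc i) u z = andF (colourF i u z)
    (allF (λ w → exactlyF (colourDegree i u w) (other z) (andF (edgeF z (other z)) (colourF i w (other z)))) z)

  eval-trueF : ∀ z (ρ : Assignment G) v → ρ z ≡ just v → eval G (trueF z) ρ ≡ true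
  eval-trueF z ρ v ρz = eval-eqF G z z ρ ∙ cong (λ o → eqᴹ o o) ρz ∙ =ᵇ-refl v

  eval-allF : ∀ {m} (φ : Fin m → Formula) z (ρ : Assignment G) v → ρ z ≡ just v →
    eval G (allF φ z) ρ ≡ allᶠ (λ w → eval G (φ w) ρ)
  eval-allF {zero} φ z ρ v ρz = eval-trueF z ρ v ρz
  eval-allF {suc m} φ z ρ v ρz = cong (eval G (φ zero) ρ ∧_) (eval-allF (φ ∘ suc) z ρ v ρz)

  update-self : ∀ (ρ : Assignment G) z w → update {G} ρ z w z ≡ just w
  update-self ρ vx w = refl
  update-self ρ vy w = refl

  update-other : ∀ (ρ : Assignment G) z w → update {G} ρ (other z) w z ≡ ρ z
  update-other ρ vx w = refl
  update-other ρ vy w = refl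

  eval-colourF : ∀ i u z (ρ : Assignment G) v → ρ z ≡ just v → eval G (colourF i u z) ρ ≡ sameColour i u v
  eval-colourF zero u z ρ v ρz = eval-trueF z ρ v ρz
  eval-colourF (suc i) u z ρ v ρz = cong₂ _∧_ (eval-colourF i u z ρ v ρz)
    (eval-allF (λ w → exactlyF (colourDegree i u w) (other z) (andF (edgeF z (other z)) (colourF i w (other z)))) z ρ v ρz
     ∙ allᶠ-cong (λ w → at-least∧¬more≡exactly (colourDegree i u w) _
                        ∙ cong (colourDegree i u w ≡ᵇ_) (countB-cong (neighbour w))))
    where
    ρ′ : V G → Assignment G
    ρ′ y = update {G} ρ (other z) y
    neighbour : ∀ w y → eval G (andF (edgeF z (other z)) (colourF i w (other z))) (ρ′ y) ≡ E G v y ∧ sameColour i w y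
    neighbour w y = cong₂ _∧_
      (eval-edgeF G z (other z) (ρ′ y) ∙ cong₂ (edgeᴹ G) (update-other ρ z y ∙ ρz) (update-self ρ (other z) y))
      (eval-colourF i w (other z) (ρ′ y) y (update-self ρ (other z) y))

record Quotient (m : ℕ) (R : Fin m → Fin m → Bool) : Set where
  field
    size  : ℕ
    class : Fin m → Fin size
    class-onto : ∀ c → ∃[ x ] class x ≡ c
    class≡⇒related : ∀ x y → class x ≡ class y → R x y ≡ true
    related⇒class≡ : ∀ x y → R x y ≡ true → class x ≡ class y

-- Vertex 0 either joins the class of some related vertex or opens a new class.
quotient : ∀ m (R : Fin m → Fin m → Bool) → (∀ x → R x x ≡ true) → (∀ x y → R x y ≡ true → R y x ≡ true) →
  (∀ x y z → R x y ≡ true → R y z ≡ true → R x z ≡ true) → Quotient m R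
quotient zero R R-refl R-sym R-trans = record
  { size = 0 ; class = λ () ; class-onto = λ () ; class≡⇒related = λ () ; related⇒class≡ = λ () }
quotient (suc m) R R-refl R-sym R-trans
  with quotient m (λ x y → R (suc x) (suc y)) (R-refl ∘ suc) (λ x y → R-sym (suc x) (suc y))
                (λ x y z → R-trans (suc x) (suc y) (suc z))
     | any? (λ y → R zero (suc y) Bool.≟ true)
... | Q | yes (y₀ , R0y₀) = record
  { size = size ; class = class′ ; class-onto = onto′ ; class≡⇒related = sound ; related⇒class≡ = complete }
  where
  open Quotient Q
  class′ : Fin (suc m) → Fin size
  class′ zero = class y₀
  class′ (suc x) = class x
  onto′ : ∀ c → ∃[ x ] class′ x ≡ c
  onto′ c with class-onto c
  ... | x , cx = suc x , cx
  sound : ∀ x y → class′ x ≡ class′ y → R x y ≡ true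
  sound zero zero _ = R-refl zero
  sound zero (suc y) same = R-trans zero (suc y₀) (suc y) R0y₀ (class≡⇒related y₀ y same)
  sound (suc x) zero same = R-trans (suc x) (suc y₀) zero (class≡⇒related x y₀ same) (R-sym zero (suc y₀) R0y₀)
  sound (suc x) (suc y) same = class≡⇒related x y same
  complete : ∀ x y → R x y ≡ true → class′ x ≡ class′ y
  complete zero zero _ = refl
  complete zero (suc y) R0y = related⇒class≡ y₀ y (R-trans (suc y₀) zero (suc y) (R-sym zero (suc y₀) R0y₀) R0y)
  complete (suc x) zero Rx0 = related⇒class≡ x y₀ (R-trans (suc x) zero (suc y₀) Rx0 R0y₀)
  complete (suc x) (suc y) Rxy = related⇒class≡ x y Rxy
... | Q | no alone = record
  { size = suc size ; class = class′ ; class-onto = onto′ ; class≡⇒related = sound ; related⇒class≡ = complete }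
  where
  open Quotient Q
  class′ : Fin (suc m) → Fin (suc size)
  class′ zero = zero
  class′ (suc x) = suc (class x)
  onto′ : ∀ c → ∃[ x ] class′ x ≡ c
  onto′ zero = zero , refl
  onto′ (suc c) with class-onto c
  ... | x , cx = suc x , cong suc cx
  sound : ∀ x y → class′ x ≡ class′ y → R x y ≡ true
  sound zero zero _ = R-refl zero
  sound (suc x) (suc y) same = class≡⇒related x y (Fin.suc-injective same)
  complete : ∀ x y → R x y ≡ true → class′ x ≡ class′ y
  complete zero zero _ = refl
  complete zero (suc y) R0y = ⊥-elim (alone (y , R0y))
  complete (suc x) zero Rx0 = ⊥-elim (alone (x , R-sym (suc x) zero Rx0))
  complete (suc x) (suc y) Rxy = cong suc (related⇒class≡ x y Rxy)

-- Degrees between two classes factor through the gcd of the class sizes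

-- With P = suc p = p′ g and Q = suc q = q′ g, the degrees of a P–Q biregular graph are t q′ and t p′.
record DegreeFactorisation (p q d₁ d₂ : ℕ) : Set where
  field
    g′ p′ q′ t : ℕ
    P≡p′g : suc p ≡ p′ * suc g′
    Q≡q′g : suc q ≡ q′ * suc g′
    d₁≡tq′ : d₁ ≡ t * q′
    d₂≡tp′ : d₂ ≡ t * p′
    t≤g : t ≤ suc g′

factorise-through : ∀ p q d₁ d₂ g p′ q′ → Coprime p′ q′ → p′ * g ≡ suc p → q′ * g ≡ suc q →
  d₁ * suc p ≡ d₂ * suc q → d₁ ≤ suc q → DegreeFactorisation p q d₁ d₂
factorise-through p q d₁ d₂ zero p′ q′ _ _ q′0≡Q _ _ with () ← sym (*-zeroʳ q′) ∙ q′0≡Q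
factorise-through p q d₁ d₂ (suc g′) p′ zero _ _ () _ _
factorise-through p q d₁ d₂ (suc g′) p′ q′@(suc _) coprime p′g≡P q′g≡Q balanced d₁≤Q = record
  { g′ = g′ ; p′ = p′ ; q′ = q′ ; t = t ; P≡p′g = sym p′g≡P ; Q≡q′g = sym q′g≡Q
  ; d₁≡tq′ = d₁≡tq′ ; d₂≡tp′ = d₂≡tp′ ; t≤g = t≤g }
  where
  g = suc g′
  d₁p′≡d₂q′ : d₁ * p′ ≡ d₂ * q′
  d₁p′≡d₂q′ = *-cancelʳ-≡ (d₁ * p′) (d₂ * q′) g (begin
    d₁ * p′ * g   ≡⟨ *-assoc d₁ p′ g ∙ cong (d₁ *_) p′g≡P ⟩
    d₁ * suc p    ≡⟨ balanced ⟩
    d₂ * suc q    ≡⟨ cong (d₂ *_) (sym q′g≡Q) ∙ sym (*-assoc d₂ q′ g) ⟩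
    d₂ * q′ * g   ∎)
    where open ≡-Reasoning
  q′∣d₁ : q′ ∣ d₁
  q′∣d₁ = coprime-divisor (Coprime.sym coprime) (divides d₂ (*-comm p′ d₁ ∙ d₁p′≡d₂q′))
  t : ℕ
  t = _∣_.quotient q′∣d₁
  d₁≡tq′ : d₁ ≡ t * q′
  d₁≡tq′ = _∣_.equality q′∣d₁
  d₂≡tp′ : d₂ ≡ t * p′
  d₂≡tp′ = *-cancelʳ-≡ d₂ (t * p′) q′ (sym (begin
    t * p′ * q′   ≡⟨ *-assoc t p′ q′ ∙ cong (t *_) (*-comm p′ q′) ∙ sym (*-assoc t q′ p′) ⟩
    t * q′ * p′   ≡⟨ cong (_* p′) (sym d₁≡tq′) ⟩
    d₁ * p′       ≡⟨ d₁p′≡d₂q′ ⟩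
    d₂ * q′       ∎))
    where open ≡-Reasoning
  t≤g : t ≤ g
  t≤g = *-cancelʳ-≤ t g q′ (subst (_≤ g * q′) d₁≡tq′ (subst (d₁ ≤_) (sym q′g≡Q ∙ *-comm q′ g) d₁≤Q))

factorise : ∀ p q d₁ d₂ → d₁ * suc p ≡ d₂ * suc q → d₁ ≤ suc q → DegreeFactorisation p q d₁ d₂
factorise p q d₁ d₂ = factorise-through p q d₁ d₂ (gcd P Q) (P / gcd P Q) (Q / gcd P Q) (coprime-/gcd P Q)
  (m/n*n≡m (gcd[m,n]∣m P Q)) (m/n*n≡m (gcd[m,n]∣n P Q))
  where
  P Q : ℕ
  P = suc p
  Q = suc q
  instance
    gcd≢0 : NonZero (gcd P Q)
    gcd≢0 = ≢-nonZero (gcd[m,n]≢0 P Q (inj₁ (λ ())))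

countℕ : ℕ → (ℕ → Bool) → ℕ
countℕ zero f = 0
countℕ (suc m) f = [ f 0 ] + countℕ m (f ∘ suc)

countB-toℕ : ∀ m (f : ℕ → Bool) → countB {m} (λ a → f (toℕ a)) ≡ countℕ m f
countB-toℕ zero f = refl
countB-toℕ (suc m) f = cong ([ f 0 ] +_) (countB-toℕ m (f ∘ suc))

countℕ-cong< : ∀ m (f g : ℕ → Bool) → (∀ x → x < m → f x ≡ g x) → countℕ m f ≡ countℕ m g
countℕ-cong< zero f g f≗g = refl
countℕ-cong< (suc m) f g f≗g =
  cong₂ _+_ (cong [_] (f≗g 0 z<s)) (countℕ-cong< m (f ∘ suc) (g ∘ suc) (λ x x<m → f≗g (suc x) (s≤s x<m)))

countℕ-cong : ∀ m {f g : ℕ → Bool} → (∀ x → f x ≡ g x) → countℕ m f ≡ countℕ m g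
countℕ-cong m {f} {g} f≗g = countℕ-cong< m f g (λ x _ → f≗g x)

countℕ-false : ∀ m (f : ℕ → Bool) → (∀ x → x < m → f x ≡ false) → countℕ m f ≡ 0
countℕ-false m f none = countℕ-cong< m f (λ _ → false) none ∙ count-none m
  where
  count-none : ∀ m → countℕ m (λ _ → false) ≡ 0
  count-none zero = refl
  count-none (suc m) = count-none m

countℕ-+ : ∀ m n (f : ℕ → Bool) → countℕ (m + n) f ≡ countℕ m f + countℕ n (λ x → f (m + x))
countℕ-+ zero n f = refl
countℕ-+ (suc m) n f = cong ([ f 0 ] +_) (countℕ-+ m n (f ∘ suc)) ∙ sym (+-assoc [ f 0 ] _ _)

countℕ-last : ∀ m (f : ℕ → Bool) → countℕ (suc m) f ≡ countℕ m f + [ f m ]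
countℕ-last zero f = +-comm [ f 0 ] 0
countℕ-last (suc m) f = cong ([ f 0 ] +_) (countℕ-last m (f ∘ suc)) ∙ sym (+-assoc [ f 0 ] _ _)

countℕ-reverse : ∀ m (f : ℕ → Bool) → countℕ m (λ a → f (m ∸ suc a)) ≡ countℕ m f
countℕ-reverse zero f = refl
countℕ-reverse (suc m) f = cong ([ f m ] +_) (countℕ-reverse m f) ∙ +-comm [ f m ] _ ∙ sym (countℕ-last m f)

countℕ-<ᵇ : ∀ g t → t ≤ g → countℕ g (_<ᵇ t) ≡ t
countℕ-<ᵇ g zero _ = countℕ-false g _ (λ _ _ → refl)
countℕ-<ᵇ (suc g) (suc t) (s≤s t≤g) = cong suc (countℕ-<ᵇ g t t≤g)

countℕ-∨ : ∀ m (a b : ℕ → Bool) → (∀ x → a x ∧ b x ≡ false) → countℕ m (λ x → a x ∨ b x) ≡ countℕ m a + countℕ m b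
countℕ-∨ zero a b disjoint = refl
countℕ-∨ (suc m) a b disjoint = begin
  [ a 0 ∨ b 0 ] + countℕ m (λ x → a (suc x) ∨ b (suc x))
    ≡⟨ cong₂ _+_ ([∨] (a 0) (b 0) (disjoint 0)) (countℕ-∨ m (a ∘ suc) (b ∘ suc) (disjoint ∘ suc)) ⟩
  ([ a 0 ] + [ b 0 ]) + (countℕ m (a ∘ suc) + countℕ m (b ∘ suc))
    ≡⟨ +-assoc [ a 0 ] _ _ ∙ cong ([ a 0 ] +_) (sym (+-assoc [ b 0 ] _ _) ∙ cong (_+ countℕ m (b ∘ suc)) (+-comm [ b 0 ] _)
       ∙ +-assoc (countℕ m (a ∘ suc)) [ b 0 ] _) ∙ sym (+-assoc [ a 0 ] _ _) ⟩
  ([ a 0 ] + countℕ m (a ∘ suc)) + ([ b 0 ] + countℕ m (b ∘ suc)) ∎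
  where
  open ≡-Reasoning
  [∨] : ∀ p q → p ∧ q ≡ false → [ p ∨ q ] ≡ [ p ] + [ q ]
  [∨] false false _ = refl
  [∨] false true  _ = refl
  [∨] true  false _ = refl

Periodic : ℕ → (ℕ → Bool) → Set
Periodic g f = ∀ x → f (x + g) ≡ f x

countℕ-shift : ∀ g (f : ℕ → Bool) → Periodic g f → ∀ c → countℕ g (λ x → f (x + c)) ≡ countℕ g f
countℕ-shift g f periodic zero = countℕ-cong g (λ x → cong f (+-identityʳ x))
countℕ-shift g f periodic (suc c) = countℕ-cong g (λ x → cong f (+-suc x c)) ∙ shift-by-one ∙ countℕ-shift g f periodic c
  where
  h : ℕ → Bool
  h x = f (x + c)
  shift-by-one : countℕ g (h ∘ suc) ≡ countℕ g h
  shift-by-one = +-cancelʳ-≡ [ h 0 ] _ _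
    (+-comm (countℕ g (h ∘ suc)) _ ∙ countℕ-last g h ∙ cong (λ b → countℕ g h + [ b ]) (cong f (+-comm g c) ∙ periodic c))

countℕ-* : ∀ g (f : ℕ → Bool) → Periodic g f → ∀ m → countℕ (m * g) f ≡ m * countℕ g f
countℕ-* g f periodic zero = refl
countℕ-* g f periodic (suc m) = countℕ-+ g (m * g) f
  ∙ cong (countℕ g f +_) (countℕ-cong (m * g) (λ x → cong f (+-comm g x) ∙ periodic x) ∙ countℕ-* g f periodic m)

countℕ-mod-shift : ∀ s (P : ℕ → Bool) c → countℕ (suc s) (λ y → P ((y + c) % suc s)) ≡ countℕ (suc s) P
countℕ-mod-shift s P c = countℕ-shift (suc s) (λ y → P (y % suc s)) (λ x → cong P ([m+n]%n≡m%n x (suc s))) c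
                       ∙ countℕ-cong< (suc s) _ _ (λ x x<S → cong P (m<n⇒m%n≡m x<S))

countℕ-mod-shift-* : ∀ g q (P : ℕ → Bool) c → countℕ (q * suc g) (λ y → P ((y + c) % suc g)) ≡ q * countℕ (suc g) P
countℕ-mod-shift-* g q P c = countℕ-* (suc g) _ periodic q ∙ cong (q *_) (countℕ-mod-shift g P c)
  where
  periodic : Periodic (suc g) (λ y → P ((y + c) % suc g))
  periodic x = cong (λ z → P (z % suc g)) (+-assoc x (suc g) c ∙ cong (x +_) (+-comm (suc g) c) ∙ sym (+-assoc x c (suc g)))
             ∙ cong P ([m+n]%n≡m%n (x + c) (suc g))

-- b + g x ≡ b - x modulo g + 1, so x ↦ (b + g x) % (g + 1) runs backwards through the residues.
countℕ-mod-reflect-* : ∀ g p (P : ℕ → Bool) b → countℕ (p * suc g) (λ x → P ((b + g * x) % suc g)) ≡ p * countℕ (suc g) P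
countℕ-mod-reflect-* g p P b =
  countℕ-* (suc g) F periodic p
  ∙ cong (p *_) (sym (countℕ-reverse (suc g) F) ∙ countℕ-cong< (suc g) _ _ reflected ∙ countℕ-mod-shift g P (suc b))
  where
  F : ℕ → Bool
  F x = P ((b + g * x) % suc g)
  periodic : Periodic (suc g) F
  periodic x = cong (λ z → P (z % suc g)) (cong (b +_) (*-distribˡ-+ g x (suc g)) ∙ sym (+-assoc b (g * x) (g * suc g)))
             ∙ cong P ([m+kn]%n≡m%n (b + g * x) g (suc g))
  identity : ∀ a y b → b + (a + y) * y + suc (a + y) ≡ (a + suc b) + y * suc (a + y)
  identity = solve-∀
  reflected : ∀ a → a < suc g → F (suc g ∸ suc a) ≡ P ((a + suc b) % suc g)
  reflected a (s≤s a≤g) = cong P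
    (sym ([m+n]%n≡m%n (b + g * (g ∸ a)) (suc g)) ∙ cong (_% suc g) shifted ∙ [m+kn]%n≡m%n (a + suc b) (g ∸ a) (suc g))
    where
    shifted : b + g * (g ∸ a) + suc g ≡ a + suc b + (g ∸ a) * suc g
    shifted = subst (λ G → b + G * (g ∸ a) + suc G ≡ a + suc b + (g ∸ a) * suc G) (m+[n∸m]≡n a≤g) (identity a (g ∸ a) b)

%-cong-+* : ∀ g a a′ b c c′ → a′ % suc g ≡ a % suc g → c′ % suc g ≡ c % suc g →
  (a′ + b * c′) % suc g ≡ (a + b * c) % suc g
%-cong-+* g a a′ b c c′ a′≡a c′≡c =
  %-distribˡ-+ a′ (b * c′) (suc g)
  ∙ cong₂ (λ u v → (u + v) % suc g) a′≡a
          (%-distribˡ-* b c′ (suc g) ∙ cong (λ w → (b % suc g * w) % suc g) c′≡c ∙ sym (%-distribˡ-* b c (suc g)))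
  ∙ sym (%-distribˡ-+ a (b * c) (suc g))

-- Under x ↦ x + 1, y ↦ y + 1 the offset y + g x of (y - x) mod (g + 1) changes by a multiple of g + 1.
offset-suc : ∀ y x g → suc y + g * suc x ≡ (y + g * x) + suc g
offset-suc = solve-∀

[m+n%d]%d≡[m+n]%d : ∀ m n d .{{_ : NonZero d}} → (m + n % d) % d ≡ (m + n) % d
[m+n%d]%d≡[m+n]%d m n d = %-distribˡ-+ m (n % d) d ∙ cong (λ z → (m % d + z) % d) (m%n%n≡m%n n d) ∙ sym (%-distribˡ-+ m n d)

-- Circulant graphs of every admissible degree

≤ᵇ-true⇒≤ : ∀ {a b} → (a ≤ᵇ b) ≡ true → a ≤ b
≤ᵇ-true⇒≤ {a} {b} a≤ᵇb = ≤ᵇ⇒≤ a b (subst T (sym a≤ᵇb) _)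

≡ᵇ-cong : ∀ a b a′ b′ → (a ≡ b → a′ ≡ b′) → (a′ ≡ b′ → a ≡ b) → (a ≡ᵇ b) ≡ (a′ ≡ᵇ b′)
≡ᵇ-cong a b a′ b′ to from with a ≡ᵇ b in ab | a′ ≡ᵇ b′ in a′b′
... | true  | true  = refl
... | false | false = refl
... | true  | false rewrite to (≡ᵇ-true⇒≡ a b ab) with () ← sym a′b′ ∙ ≡ᵇ-refl b′
... | false | true  rewrite from (≡ᵇ-true⇒≡ a′ b′ a′b′) with () ← sym ab ∙ ≡ᵇ-refl b

countℕ-≡ᵇ : ∀ m h → h < m → countℕ m (_≡ᵇ h) ≡ 1
countℕ-≡ᵇ (suc m) zero _ = cong suc (countℕ-false m _ (λ _ _ → refl))
countℕ-≡ᵇ (suc m) (suc h) (s≤s h<m) = countℕ-≡ᵇ m h h<m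

+-self-injective : ∀ a b → a + a ≡ b + b → a ≡ b
+-self-injective a b a+a≡b+b with <-cmp a b
... | tri< a<b _ _ = ⊥-elim (<-irrefl a+a≡b+b (+-mono-< a<b a<b))
... | tri≈ _ a≡b _ = a≡b
... | tri> _ _ b<a = ⊥-elim (<-irrefl (sym a+a≡b+b) (+-mono-< b<a b<a))

-- The circulant graph on ℤ/(s+1) with connection set ±{1..t}, plus (s+1)/2 when odd.
module Circulant (s t : ℕ) (odd : Bool) (2t+odd≤s : t + t + [ odd ] ≤ s)
  (odd⇒size-even : odd ≡ true → ∃[ h ] suc s ≡ h + h) where

  S : ℕ
  S = suc s

  -- y - x modulo S, computed without truncated subtraction
  offset : ℕ → ℕ → ℕ
  offset x y = (y + s * x) % S

  near : ℕ → Bool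
  near δ = (1 ≤ᵇ δ) ∧ (δ ≤ᵇ t)

  antipodal : ℕ → Bool
  antipodal δ = odd ∧ (δ + δ ≡ᵇ S)

  connection : ℕ → Bool
  connection δ = near δ ∨ (near (S ∸ δ) ∨ antipodal δ)

  adjacent : ℕ → ℕ → Bool
  adjacent x y = connection (offset x y)

  t+t≤s : t + t ≤ s
  t+t≤s = ≤-trans (m≤m+n (t + t) [ odd ]) 2t+odd≤s

  t<S : t < S
  t<S = s≤s (≤-trans (m≤m+n t t) t+t≤s)

  adjacent-irrefl : ∀ x → adjacent x x ≡ false
  adjacent-irrefl x = cong connection offset-zero ∙ cong₂ _∨_ (S≰ᵇt) (∧-zeroʳ odd)
    where
    offset-zero : offset x x ≡ 0
    offset-zero = cong (_% S) (+-comm x (s * x) ∙ cong (_+ x) (*-comm s x) ∙ +-comm (x * s) x ∙ sym (*-suc x s)) ∙ m*n%n≡0 x S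
    S≰ᵇt : (S ≤ᵇ t) ≡ false
    S≰ᵇt with S ≤ᵇ t in S≤ᵇt
    ... | false = refl
    ... | true  = ⊥-elim (<⇒≱ t<S (≤ᵇ-true⇒≤ S≤ᵇt))

  adjacent-rotate : ∀ x y → adjacent (suc x % S) (suc y % S) ≡ adjacent x y
  adjacent-rotate x y = cong connection
    (%-cong-+* s (suc y) (suc y % S) s (suc x) (suc x % S) (m%n%n≡m%n (suc y) S) (m%n%n≡m%n (suc x) S)
     ∙ cong (_% S) (offset-suc y x s) ∙ [m+n]%n≡m%n (y + s * x) S)

  offset-flip : ∀ x y → offset y x ≡ (S ∸ offset x y) % S
  offset-flip x y with sum≡0∨S (offset x y + offset y x) (+-mono-< (m%n<n (y + s * x) S) (m%n<n (x + s * y) S)) sum%S≡0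
    where
    sum≡0∨S : ∀ z → z < S + S → z % S ≡ 0 → z ≡ 0 ⊎ z ≡ S
    sum≡0∨S z z<2S z%S≡0 with z <? S
    ... | yes z<S = inj₁ (sym (m<n⇒m%n≡m z<S) ∙ z%S≡0)
    ... | no z≮S = inj₂ (sym S+w≡z ∙ cong (S +_) w≡0 ∙ +-identityʳ S)
      where
      w = z ∸ S
      S+w≡z : S + w ≡ z
      S+w≡z = m+[n∸m]≡n (≮⇒≥ z≮S)
      w≡0 : w ≡ 0
      w≡0 = sym (m<n⇒m%n≡m (+-cancelˡ-< S w S (subst (_< S + S) (sym S+w≡z) z<2S)))
          ∙ sym ([m+n]%n≡m%n w S) ∙ cong (_% S) (+-comm w S ∙ S+w≡z) ∙ z%S≡0
    sum-identity : ∀ s x y → (y + s * x) + (x + s * y) ≡ (x + y) * suc s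
    sum-identity = solve-∀
    sum%S≡0 : (offset x y + offset y x) % S ≡ 0
    sum%S≡0 = %-distribˡ-+ (offset x y) (offset y x) S
            ∙ cong₂ (λ u v → (u + v) % S) (m%n%n≡m%n (y + s * x) S) (m%n%n≡m%n (x + s * y) S)
            ∙ sym (%-distribˡ-+ (y + s * x) (x + s * y) S) ∙ cong (_% S) (sum-identity s x y) ∙ m*n%n≡0 (x + y) S
  ... | inj₁ sum≡0 =
    m+n≡0⇒n≡0 (offset x y) sum≡0 ∙ sym (n%n≡0 S) ∙ cong (λ z → (S ∸ z) % S) (sym (m+n≡0⇒m≡0 (offset x y) sum≡0))
  ... | inj₂ sum≡S = sym (m<n⇒m%n≡m (m%n<n (x + s * y) S))
    ∙ cong (_% S) (sym (m+n∸m≡n (offset x y) (offset y x)) ∙ cong (_∸ offset x y) sum≡S)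

  connection-flip : ∀ δ → δ < S → connection ((S ∸ δ) % S) ≡ connection δ
  connection-flip zero _ = cong connection (n%n≡0 S)
  connection-flip (suc δ) δ<S =
    cong connection (m<n⇒m%n≡m S-δ<S)
    ∙ cong₂ (λ u v → near ε ∨ (near u ∨ v)) S-ε≡δ antipodal-flip
    ∙ swap (near ε) (near (suc δ)) (antipodal (suc δ))
    where
    ε : ℕ
    ε = S ∸ suc δ
    S-δ<S : ε < S
    S-δ<S = ∸-monoʳ-< {S} {suc δ} {0} z<s (<⇒≤ δ<S)
    S-ε≡δ : S ∸ ε ≡ suc δ
    S-ε≡δ = m∸[m∸n]≡n (<⇒≤ δ<S)
    δ+ε≡S : suc δ + ε ≡ S
    δ+ε≡S = m+[n∸m]≡n (<⇒≤ δ<S)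
    antipodal-flip : antipodal ε ≡ antipodal (suc δ)
    antipodal-flip = cong (odd ∧_) (≡ᵇ-cong _ _ _ _
      (λ h → cong (λ z → z + z) (+-cancelʳ-≡ ε (suc δ) ε (δ+ε≡S ∙ sym h)) ∙ h)
      (λ h → cong (λ z → z + z) (+-cancelˡ-≡ (suc δ) ε (suc δ) (δ+ε≡S ∙ sym h)) ∙ h))
    swap : ∀ a b c → a ∨ (b ∨ c) ≡ b ∨ (a ∨ c)
    swap a b c = sym (∨-assoc a b c) ∙ cong (_∨ c) (∨-comm a b) ∙ ∨-assoc b a c

  adjacent-sym : ∀ x y → adjacent y x ≡ adjacent x y
  adjacent-sym x y = cong connection (offset-flip x y) ∙ connection-flip (offset x y) (m%n<n (y + s * x) S)

  count-near : countℕ S near ≡ t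
  count-near = countℕ-<ᵇ s t (≤-trans (m≤m+n t t) t+t≤s)

  count-near-neg : countℕ S (λ δ → near (S ∸ δ)) ≡ t
  count-near-neg = sym (countℕ-reverse S (λ δ → near (S ∸ δ)))
    ∙ countℕ-cong< S _ (_<ᵇ t) (λ a a<S → cong near (m∸[m∸n]≡n a<S)) ∙ countℕ-<ᵇ S t (<⇒≤ t<S)

  count-antipodal : countℕ S antipodal ≡ [ odd ]
  count-antipodal = by-parity odd refl
    where
    half<S : ∀ h → S ≡ h + h → h < S
    half<S (suc h′) S≡ = subst (suc h′ <_) (sym S≡) (m<m+n (suc h′) z<s)
    by-parity : ∀ b → odd ≡ b → countℕ S antipodal ≡ [ b ]
    by-parity false odd≡false = countℕ-false S antipodal (λ δ _ → cong (_∧ (δ + δ ≡ᵇ S)) odd≡false)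
    by-parity true odd≡true with odd⇒size-even odd≡true
    ... | h , S≡h+h = countℕ-cong S (λ δ → cong (_∧ (δ + δ ≡ᵇ S)) odd≡true ∙ cong (δ + δ ≡ᵇ_) S≡h+h
                                         ∙ ≡ᵇ-cong _ _ _ _ (+-self-injective δ h) (cong (λ z → z + z)))
                    ∙ countℕ-≡ᵇ S h (half<S h S≡h+h)

  2δ≤2t<S : ∀ δ → δ ≤ t → S ≤ δ + δ → ⊥
  2δ≤2t<S δ δ≤t S≤2δ = <⇒≱ (s≤s (≤-trans (+-mono-≤ δ≤t δ≤t) t+t≤s)) S≤2δ

  near-disjoint : ∀ δ → near δ ∧ near (S ∸ δ) ≡ false
  near-disjoint δ = ∧-false (near δ) (near (S ∸ δ)) contra
    where
    contra : near δ ≡ true → near (S ∸ δ) ≡ true → ⊥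
    contra nδ n-δ = <⇒≱ (s≤s (≤-trans (+-mono-≤ δ≤t S-δ≤t) t+t≤s)) (≤-reflexive (sym (m+[n∸m]≡n (<⇒≤ δ<S))))
      where
      δ≤t : δ ≤ t
      δ≤t = ≤ᵇ-true⇒≤ (proj₂ (∧-true {1 ≤ᵇ δ} nδ))
      S-δ≤t : S ∸ δ ≤ t
      S-δ≤t = ≤ᵇ-true⇒≤ (proj₂ (∧-true {1 ≤ᵇ S ∸ δ} n-δ))
      δ<S : δ < S
      δ<S = m∸n≢0⇒n<m (λ S-δ≡0 → n≮n 0 (subst (0 <_) S-δ≡0 (≤ᵇ-true⇒≤ (proj₁ (∧-true {1 ≤ᵇ S ∸ δ} n-δ)))))

  near-antipodal-disjoint : ∀ δ → near δ ∧ antipodal δ ≡ false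
  near-antipodal-disjoint δ = ∧-false (near δ) (antipodal δ) λ nδ aδ →
    2δ≤2t<S δ (≤ᵇ-true⇒≤ (proj₂ (∧-true {1 ≤ᵇ δ} nδ))) (≤-reflexive (sym (≡ᵇ-true⇒≡ _ _ (proj₂ (∧-true {odd} aδ)))))

  near-neg-antipodal-disjoint : ∀ δ → near (S ∸ δ) ∧ antipodal δ ≡ false
  near-neg-antipodal-disjoint δ = ∧-false (near (S ∸ δ)) (antipodal δ) λ n-δ aδ →
    let 2δ≡S = ≡ᵇ-true⇒≡ _ _ (proj₂ (∧-true {odd} aδ)) in
    2δ≤2t<S δ (subst (_≤ t) (cong (_∸ δ) (sym 2δ≡S) ∙ m+n∸m≡n δ δ) (≤ᵇ-true⇒≤ (proj₂ (∧-true {1 ≤ᵇ S ∸ δ} n-δ))))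
              (≤-reflexive (sym 2δ≡S))

  count-connection : countℕ S connection ≡ t + (t + [ odd ])
  count-connection =
    countℕ-∨ S near (λ δ → near (S ∸ δ) ∨ antipodal δ) disjoint
    ∙ cong₂ _+_ count-near (countℕ-∨ S (λ δ → near (S ∸ δ)) antipodal near-neg-antipodal-disjoint
                            ∙ cong₂ _+_ count-near-neg count-antipodal)
    where
    disjoint : ∀ δ → near δ ∧ (near (S ∸ δ) ∨ antipodal δ) ≡ false
    disjoint δ = ∧-distribˡ-∨ (near δ) _ _ ∙ cong₂ _∨_ (near-disjoint δ) (near-antipodal-disjoint δ)

  degree : ∀ x → countℕ S (adjacent x) ≡ t + (t + [ odd ])
  degree x = countℕ-mod-shift s connection (s * x) ∙ count-connection

Point : ∀ k → (Fin k → ℕ) → Set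
Point k size = Σ (Fin k) (λ c → Fin (size c))

encode : ∀ {k} (size : Fin k → ℕ) → Point k size → Fin (sum size)
encode {suc k} size (zero , a) = a ↑ˡ sum (size ∘ suc)
encode {suc k} size (suc c , a) = size zero ↑ʳ encode (size ∘ suc) (c , a)

decode : ∀ {k} (size : Fin k → ℕ) → Fin (sum size) → Point k size
decode-split : ∀ {k} (size : Fin (suc k) → ℕ) → Fin (size zero) ⊎ Fin (sum (size ∘ suc)) → Point (suc k) size
decode {zero} size ()
decode {suc k} size x = decode-split size (splitAt (size zero) x)
decode-split size (inj₁ a) = zero , a
decode-split size (inj₂ y) with decode (size ∘ suc) y
... | c , a = suc c , a

decode-encode : ∀ {k} (size : Fin k → ℕ) p → decode size (encode size p) ≡ p
decode-encode {suc k} size (zero , a) rewrite splitAt-↑ˡ (size zero) a (sum (size ∘ suc)) = refl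
decode-encode {suc k} size (suc c , a)
  rewrite splitAt-↑ʳ (size zero) (sum (size ∘ suc)) (encode (size ∘ suc) (c , a)) | decode-encode (size ∘ suc) (c , a) = refl

encode-decode : ∀ {k} (size : Fin k → ℕ) x → encode size (decode size x) ≡ x
encode-decode {zero} size ()
encode-decode {suc k} size x with splitAt (size zero) x in split
... | inj₁ a = splitAt⁻¹-↑ˡ split
... | inj₂ y = cong (size zero ↑ʳ_) (encode-decode (size ∘ suc) y) ∙ splitAt⁻¹-↑ʳ split

countB-+ : ∀ m n (f : Fin (m + n) → Bool) → countB f ≡ countB (λ a → f (a ↑ˡ n)) + countB (λ b → f (m ↑ʳ b))
countB-+ zero n f = refl
countB-+ (suc m) n f = cong ([ f zero ] +_) (countB-+ m n (f ∘ suc)) ∙ sym (+-assoc [ f zero ] _ _)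

countB-blocks : ∀ {k} (size : Fin k → ℕ) (f : Fin (sum size) → Bool) →
  countB f ≡ sum (λ c → countB {size c} (λ a → f (encode size (c , a))))
countB-blocks {zero} size f = refl
countB-blocks {suc k} size f = countB-+ (size zero) (sum (size ∘ suc)) f
  ∙ cong (countB (λ a → f (a ↑ˡ sum (size ∘ suc))) +_) (countB-blocks (size ∘ suc) (λ b → f (size zero ↑ʳ b)))

conjugate : ∀ {k} (size : Fin k → ℕ) → (Point k size → Point k size) → Fin (sum size) → Fin (sum size)
conjugate size f u = encode size (f (decode size u))

conjugate-inverse : ∀ {k} (size : Fin k → ℕ) (f g : Point k size → Point k size) →
  (∀ p → f (g p) ≡ p) → ∀ u → conjugate size f (conjugate size g u) ≡ u
conjugate-inverse size f g f∘g≡id u = cong (encode size ∘ f) (decode-encode size (g (decode size u)))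
  ∙ cong (encode size) (f∘g≡id (decode size u)) ∙ encode-decode size u

rotate : ∀ {s} → ℕ → Fin (suc s) → Fin (suc s)
rotate {s} j a = fromℕ< (m%n<n (j + toℕ a) (suc s))

toℕ-rotate : ∀ {s} j (a : Fin (suc s)) → toℕ (rotate j a) ≡ (j + toℕ a) % suc s
toℕ-rotate {s} j a = toℕ-fromℕ< (m%n<n (j + toℕ a) (suc s))

rotate-by : ∀ {s} j (a b : Fin (suc s)) → (j + toℕ a) % suc s ≡ toℕ b → rotate j a ≡ b
rotate-by j a b eq = toℕ-injective (toℕ-rotate j a ∙ eq)

rotate-zero : ∀ {s} (a : Fin (suc s)) → rotate 0 a ≡ a
rotate-zero a = rotate-by 0 a a (m<n⇒m%n≡m (toℕ<n a))

rotate-rotate : ∀ {s} i j (a : Fin (suc s)) → rotate i (rotate j a) ≡ rotate (i + j) a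
rotate-rotate {s} i j a = rotate-by i (rotate j a) (rotate (i + j) a)
  (cong (λ z → (i + z) % suc s) (toℕ-rotate j a) ∙ [m+n%d]%d≡[m+n]%d i (j + toℕ a) (suc s)
   ∙ cong (_% suc s) (sym (+-assoc i j (toℕ a))) ∙ sym (toℕ-rotate (i + j) a))

rotate-full : ∀ {s} (a : Fin (suc s)) → rotate (suc s) a ≡ a
rotate-full {s} a = rotate-by (suc s) a a
  (cong (_% suc s) (+-comm (suc s) (toℕ a)) ∙ [m+n]%n≡m%n (toℕ a) (suc s) ∙ m<n⇒m%n≡m (toℕ<n a))

rotate-reaches : ∀ {s} (a b : Fin (suc s)) → rotate (toℕ b + s * toℕ a) a ≡ b
rotate-reaches {s} a b = rotate-by (toℕ b + s * toℕ a) a b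
  (cong (_% suc s) (identity (toℕ a) (toℕ b) s) ∙ [m+kn]%n≡m%n (toℕ b) (toℕ a) (suc s) ∙ m<n⇒m%n≡m (toℕ<n b))
  where
  identity : ∀ a b s → b + s * a + a ≡ b + a * suc s
  identity = solve-∀

-- Realising the parameters of an equitable partition by a multi-circulant graph

halve : ℕ → ℕ × Bool
halve zero = 0 , false
halve (suc zero) = 0 , true
halve (suc (suc n)) = suc (proj₁ (halve n)) , proj₂ (halve n)

halve-correct : ∀ n → n ≡ proj₁ (halve n) + (proj₁ (halve n) + [ proj₂ (halve n) ])
halve-correct zero = refl
halve-correct (suc zero) = refl
halve-correct (suc (suc n)) = cong (λ m → suc (suc m)) (halve-correct n) ∙ cong suc (sym (+-suc h (h + [ odd ])))
  where
  h : ℕ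
  h = proj₁ (halve n)
  odd : Bool
  odd = proj₂ (halve n)

odd≢even : ∀ a b → suc (a + a) ≡ b + b → ⊥
odd≢even a zero ()
odd≢even zero (suc b) eq with () ← suc-injective eq ∙ +-suc b b
odd≢even (suc a) (suc b) eq = odd≢even a b (suc-injective (cong suc (sym (+-suc a a)) ∙ suc-injective eq ∙ +-suc b b))

odd*m-even⇒m-even : ∀ t m e → suc (t + t) * m ≡ e + e → ∃[ h ] m ≡ h + h
odd*m-even⇒m-even t m e eq with halve m | halve-correct m
... | h , false | m≡ = h , m≡ ∙ cong (h +_) (+-identityʳ h)
... | h , true  | m≡ = ⊥-elim (odd≢even (t * h + t * h + t + h) e (sym (identity t h) ∙ cong (suc (t + t) *_) odd-m ∙ eq))
  where
  identity : ∀ t h → suc (t + t) * (h + suc h) ≡ suc ((t * h + t * h + t + h) + (t * h + t * h + t + h))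
  identity = solve-∀
  odd-m : h + suc h ≡ m
  odd-m = cong (h +_) (sym (+-comm h 1)) ∙ sym m≡

-- Class sizes suc (pred-size i) and the number degree i j of neighbours in class j of a vertex in class i.
record Parameters : Set where
  field
    classes : ℕ
    pred-size : Fin classes → ℕ
    degree : Fin classes → Fin classes → ℕ
    degree-balanced : ∀ i j → degree i j * suc (pred-size i) ≡ degree j i * suc (pred-size j)
    degree≤size : ∀ i j → degree i j ≤ suc (pred-size j)
    self-degree<size : ∀ i → degree i i ≤ pred-size i
    self-degree-even : ∀ i → ∃[ e ] degree i i * suc (pred-size i) ≡ e + e

module Realisation (D : Parameters) where
  open Parameters D

  size : Fin classes → ℕ
  size c = suc (pred-size c)

  half : Fin classes → ℕ
  half c = proj₁ (halve (degree c c))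

  odd : Fin classes → Bool
  odd c = proj₂ (halve (degree c c))

  self-degree≡ : ∀ c → degree c c ≡ half c + (half c + [ odd c ])
  self-degree≡ c = halve-correct (degree c c)

  2half+odd≤ : ∀ c → half c + half c + [ odd c ] ≤ pred-size c
  2half+odd≤ c = subst (_≤ pred-size c) (self-degree≡ c ∙ sym (+-assoc (half c) (half c) _)) (self-degree<size c)

  odd⇒size-even : ∀ c → odd c ≡ true → ∃[ h ] size c ≡ h + h
  odd⇒size-even c odd≡true with self-degree-even c
  ... | e , even = odd*m-even⇒m-even (half c) (size c) e (cong (_* size c) (sym degree≡) ∙ even)
    where
    degree≡ : degree c c ≡ suc (half c + half c)
    degree≡ = self-degree≡ c ∙ cong (λ o → half c + (half c + [ o ])) odd≡true
            ∙ cong (half c +_) (+-comm (half c) 1) ∙ +-suc (half c) (half c)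

  module Within (c : Fin classes) = Circulant (pred-size c) (half c) (odd c) (2half+odd≤ c) (odd⇒size-even c)

  between : ∀ i j → DegreeFactorisation (pred-size i) (pred-size j) (degree i j) (degree j i)
  between i j = factorise (pred-size i) (pred-size j) (degree i j) (degree j i) (degree-balanced i j) (degree≤size i j)

  -- x in class i and y in class j are adjacent when (y - x) mod g lies below t.
  across : Fin classes → Fin classes → ℕ → ℕ → Bool
  across i j x y = ((y + g′ * x) % suc g′) <ᵇ t
    where open DegreeFactorisation (between i j)

  adjacentBy : ∀ {c c′} → Tri (c <ᶠ c′) (c ≡ c′) (c′ <ᶠ c) → ℕ → ℕ → Bool
  adjacentBy {c} {c′} (tri< _ _ _) x y = across c c′ x y
  adjacentBy {c}      (tri≈ _ _ _) x y = Within.adjacent c x y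
  adjacentBy {c} {c′} (tri> _ _ _) x y = across c′ c y x

  blockAdjacent : Fin classes → ℕ → Fin classes → ℕ → Bool
  blockAdjacent c x c′ y = adjacentBy (Fin.<-cmp c c′) x y

  blockAdjacent-sym : ∀ c x c′ y → blockAdjacent c x c′ y ≡ blockAdjacent c′ y c x
  blockAdjacent-sym c x c′ y with Fin.<-cmp c c′ | Fin.<-cmp c′ c
  ... | tri< _ _ _    | tri> _ _ _    = refl
  ... | tri≈ _ refl _ | tri≈ _ _ _    = sym (Within.adjacent-sym c x y)
  ... | tri> _ _ _    | tri< _ _ _    = refl
  ... | tri< c<c′ _ _ | tri< c′<c _ _ = ⊥-elim (Fin.<-asym c<c′ c′<c)
  ... | tri< _ c≢c′ _ | tri≈ _ c′≡c _ = ⊥-elim (c≢c′ (sym c′≡c))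
  ... | tri≈ _ c≡c′ _ | tri< _ c′≢c _ = ⊥-elim (c′≢c (sym c≡c′))
  ... | tri≈ _ c≡c′ _ | tri> _ c′≢c _ = ⊥-elim (c′≢c (sym c≡c′))
  ... | tri> _ c≢c′ _ | tri≈ _ c′≡c _ = ⊥-elim (c≢c′ (sym c′≡c))
  ... | tri> _ _ c′<c | tri> _ _ c<c′ = ⊥-elim (Fin.<-asym c<c′ c′<c)

  blockAdjacent-irrefl : ∀ c x → blockAdjacent c x c x ≡ false
  blockAdjacent-irrefl c x with Fin.<-cmp c c
  ... | tri< c<c _ _ = ⊥-elim (Fin.<-irrefl refl c<c)
  ... | tri≈ _ _ _   = Within.adjacent-irrefl c x
  ... | tri> _ _ c<c = ⊥-elim (Fin.<-irrefl refl c<c)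

  adjacentᴾ : Point classes size → Point classes size → Bool
  adjacentᴾ (c , a) (c′ , b) = blockAdjacent c (toℕ a) c′ (toℕ b)

  H : Graph
  H = record
    { n = sum size
    ; E = λ u v → adjacentᴾ (decode size u) (decode size v)
    ; sym = λ u v → blockAdjacent-sym (proj₁ (decode size u)) (toℕ (proj₂ (decode size u)))
                                      (proj₁ (decode size v)) (toℕ (proj₂ (decode size v)))
    ; loopless = λ u → blockAdjacent-irrefl (proj₁ (decode size u)) (toℕ (proj₂ (decode size u)))
    }

  block : V H → Fin classes
  block u = proj₁ (decode size u)

  Π : Partition H
  Π = record { k = classes ; cls = block ; onto = λ c → encode size (c , zero) , cong proj₁ (decode-encode size (c , zero)) }

  countB-block : ∀ (F : Point classes size → Bool) →
    countB (λ u → F (decode size u)) ≡ sum (λ c → countB {size c} (λ a → F (c , a)))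
  countB-block F = countB-blocks size (λ u → F (decode size u))
    ∙ sum-cong-≗ (λ c → countB-cong (λ a → cong F (decode-encode size (c , a))))

  block-size : ∀ c → classSize H block c ≡ size c
  block-size c = countB-block (λ p → proj₁ p =ᵇ c)
    ∙ sum-cong-≗ (λ c′ → countB-const (size c′) (c′ =ᵇ c) ∙ cong (λ b → if b then size c′ else 0) (=ᵇ-sym c′ c))
    ∙ sum-point c size

  blockAdjacent-degree : ∀ c c″ x → countℕ (size c″) (blockAdjacent c x c″) ≡ degree c c″
  blockAdjacent-degree c c″ x with Fin.<-cmp c c″
  ... | tri< _ _ _ = cong (λ m → countℕ m (across c c″ x)) Q≡q′g
                   ∙ countℕ-mod-shift-* g′ q′ (_<ᵇ t) (g′ * x) ∙ cong (q′ *_) (countℕ-<ᵇ (suc g′) t t≤g) ∙ *-comm q′ t ∙ sym d₁≡tq′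
    where open DegreeFactorisation (between c c″)
  ... | tri≈ _ refl _ = Within.degree c x ∙ sym (self-degree≡ c)
  ... | tri> _ _ _ = cong (λ m → countℕ m (λ y → across c″ c y x)) P≡p′g
                   ∙ countℕ-mod-reflect-* g′ p′ (_<ᵇ t) x ∙ cong (p′ *_) (countℕ-<ᵇ (suc g′) t t≤g) ∙ *-comm p′ t ∙ sym d₂≡tp′
    where open DegreeFactorisation (between c″ c)

  block-degree : ∀ u c″ → classDegree H block u c″ ≡ degree (block u) c″
  block-degree u c″ = countB-block (λ p → adjacentᴾ (decode size u) p ∧ (proj₁ p =ᵇ c″))
    ∙ sum-cong-≗ (λ c′ → countB-∧ʳ (λ b → adjacentᴾ (decode size u) (c′ , b)) (c′ =ᵇ c″)
                       ∙ cong (λ e → if e then countB (λ b → adjacentᴾ (decode size u) (c′ , b)) else 0) (=ᵇ-sym c′ c″))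
    ∙ sum-point c″ (λ c′ → countB {size c′} (λ b → adjacentᴾ (decode size u) (c′ , b)))
    ∙ countB-toℕ (size c″) (blockAdjacent (block u) (toℕ (proj₂ (decode size u))) c″)
    ∙ blockAdjacent-degree (block u) c″ (toℕ (proj₂ (decode size u)))

  rotateᴾ : ℕ → Point classes size → Point classes size
  rotateᴾ j (c , a) = c , rotate j a

  unrotateᴾ : Point classes size → Point classes size
  unrotateᴾ (c , a) = c , rotate (pred-size c) a

  σ : Permutation′ (sum size)
  σ = permutation (conjugate size (rotateᴾ 1)) (conjugate size unrotateᴾ)
    (conjugate-inverse size (rotateᴾ 1) unrotateᴾ (λ { (c , a) → cong (c ,_) (rotate-rotate 1 (pred-size c) a ∙ rotate-full a) }))
    (conjugate-inverse size unrotateᴾ (rotateᴾ 1) (λ { (c , a) → cong (c ,_)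
      (rotate-rotate (pred-size c) 1 a ∙ cong (λ j → rotate j a) (+-comm (pred-size c) 1) ∙ rotate-full a) }))

  across-rotate : ∀ i j x y → across i j (suc x % size i) (suc y % size j) ≡ across i j x y
  across-rotate i j x y = cong (_<ᵇ t)
    (%-cong-+* g′ (suc y) (suc y % size j) g′ (suc x) (suc x % size i)
       (m∣n⇒o%n%m≡o%m (suc g′) (size j) (suc y) (divides q′ Q≡q′g))
       (m∣n⇒o%n%m≡o%m (suc g′) (size i) (suc x) (divides p′ P≡p′g))
     ∙ cong (_% suc g′) (offset-suc y x g′) ∙ [m+n]%n≡m%n (y + g′ * x) (suc g′))
    where open DegreeFactorisation (between i j)

  blockAdjacent-rotate : ∀ c x c′ y → blockAdjacent c (suc x % size c) c′ (suc y % size c′) ≡ blockAdjacent c x c′ y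
  blockAdjacent-rotate c x c′ y with Fin.<-cmp c c′
  ... | tri< _ _ _    = across-rotate c c′ x y
  ... | tri≈ _ refl _ = Within.adjacent-rotate c x y
  ... | tri> _ _ _    = across-rotate c′ c y x

  σ-automorphism : IsAutomorphism H σ
  σ-automorphism u v =
    cong₂ adjacentᴾ (decode-encode size (rotateᴾ 1 (decode size u))) (decode-encode size (rotateᴾ 1 (decode size v)))
    ∙ cong₂ (λ x y → blockAdjacent (block u) x (block v) y)
            (toℕ-rotate 1 (proj₂ (decode size u))) (toℕ-rotate 1 (proj₂ (decode size v)))
    ∙ blockAdjacent-rotate (block u) (toℕ (proj₂ (decode size u))) (block v) (toℕ (proj₂ (decode size v)))

  iterate-σ : ∀ j c a → iterate σ j (encode size (c , a)) ≡ encode size (c , rotate j a)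
  iterate-σ zero c a = cong (λ b → encode size (c , b)) (sym (rotate-zero a))
  iterate-σ (suc j) c a = cong (conjugate size (rotateᴾ 1)) (iterate-σ j c a)
    ∙ cong (encode size ∘ rotateᴾ 1) (decode-encode size (c , rotate j a)) ∙ cong (λ b → encode size (c , b)) (rotate-rotate 1 j a)

  iterate-σ-block : ∀ j u → block (iterate σ j u) ≡ block u
  iterate-σ-block j u = cong (block ∘ iterate σ j) (sym (encode-decode size u))
    ∙ cong block (iterate-σ j (block u) (proj₂ (decode size u)))
    ∙ cong proj₁ (decode-encode size (block u , rotate j (proj₂ (decode size u))))

  σ-cycles : CyclesAre H σ Π
  σ-cycles u v = reach (decode size u) (decode size v) (encode-decode size u) (encode-decode size v)
               , λ { (j , σʲu≡v) → sym (iterate-σ-block j u) ∙ cong block σʲu≡v }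
    where
    reach : ∀ p q → encode size p ≡ u → encode size q ≡ v → proj₁ p ≡ proj₁ q → ∃[ j ] iterate σ j u ≡ v
    reach (c , a) (.c , b) p≡u q≡v refl = j ,
      (cong (iterate σ j) (sym p≡u) ∙ iterate-σ j c a ∙ cong (λ b′ → encode size (c , b′)) (rotate-reaches a b) ∙ q≡v)
      where
      j : ℕ
      j = toℕ b + pred-size c * toℕ a

-- The stable colouring of G and its realisation

equitable⇒same-eval : ∀ (H : Graph) (Π : Partition H) → Equitable H Π →
  ∀ φ {u v} → cls Π u ≡ cls Π v → eval H φ (assignX H u) ≡ eval H φ (assignX H v)
equitable⇒same-eval H Π equitable φ same =
  Matched⇒same-eval φ (Matched-assignX same)
  where open Transfer H H (cls Π) (cls Π) (λ _ → refl) equitable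

module StableColouring (G : Graph) where
  open ColourRefinement G

  stabilisation : ∃[ j ] ∀ u v → sameColour (suc j) u v ≡ sameColour j u v
  stabilisation = stabilises (sameColourPairs 0) 0 ≤-refl

  rounds : ℕ
  rounds = proj₁ stabilisation

  Same : V G → V G → Bool
  Same = sameColour rounds

  Q : Quotient (n G) Same
  Q = quotient (n G) Same (sameColour-refl rounds) (λ x y Sxy → sameColour-sym rounds y x ∙ Sxy) (sameColour-trans rounds)

  open Quotient Q

  representative : Fin size → V G
  representative c = proj₁ (class-onto c)

  class-representative : ∀ c → class (representative c) ≡ c
  class-representative c = proj₂ (class-onto c)

  class=ᵇ : ∀ c y → (class y =ᵇ c) ≡ Same (representative c) y
  class=ᵇ c y with class y ≟ c
  ... | yes class≡c = sym (class≡⇒related (representative c) y (class-representative c ∙ sym class≡c))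
  ... | no class≢c with Same (representative c) y in related
  ...   | false = refl
  ...   | true  = ⊥-elim (class≢c (sym (related⇒class≡ (representative c) y related) ∙ class-representative c))

  -- A further round of refinement changes nothing, so same-coloured vertices have equal colour degrees.
  class-equitable : ∀ u v → class u ≡ class v → ∀ c → classDegree G class u c ≡ classDegree G class v c
  class-equitable u v same c =
    countB-cong (λ w → cong (E G u w ∧_) (class=ᵇ c w))
    ∙ sameColour-suc⇒colourDegree rounds u v (proj₂ stabilisation u v ∙ class≡⇒related u v same) (representative c)
    ∙ sym (countB-cong (λ w → cong (E G v w ∧_) (class=ᵇ c w)))

  degree : Fin size → Fin size → ℕ
  degree c c′ = classDegree G class (representative c) c′

  classDegree≡degree : ∀ u c → classDegree G class u c ≡ degree (class u) c
  classDegree≡degree u c = class-equitable u (representative (class u)) (sym (class-representative (class u))) c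

  classSize-positive : ∀ c → 0 < classSize G class c
  classSize-positive c = subst (_< classSize G class c) (countB-const (n G) false)
    (countB-mono-< (λ _ → false) (λ x → class x =ᵇ c) (λ _ ()) (representative c) refl
                   (cong (_=ᵇ c) (class-representative c) ∙ =ᵇ-refl c))

  pred-size : Fin size → ℕ
  pred-size c = classSize G class c ∸ 1

  classSize≡ : ∀ c → classSize G class c ≡ suc (pred-size c)
  classSize≡ c = sym (m+[n∸m]≡n (classSize-positive c))

  edgeFrom : Fin size → Fin size → V G → V G → Bool
  edgeFrom i j u v = ((class u =ᵇ i) ∧ E G u v) ∧ (class v =ᵇ j)

  edgeFrom-flip : ∀ i j u v → edgeFrom i j u v ≡ edgeFrom j i v u
  edgeFrom-flip i j u v = cong (λ e → ((class u =ᵇ i) ∧ e) ∧ (class v =ᵇ j)) (edge-sym G u v)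
                        ∙ flip (class u =ᵇ i) (E G v u) (class v =ᵇ j)
    where
    flip : ∀ a b c → (a ∧ b) ∧ c ≡ (c ∧ b) ∧ a
    flip a b c = ∧-comm (a ∧ b) c ∙ cong (c ∧_) (∧-comm a b) ∙ sym (∧-assoc c b a)

  edgesBetween : Fin size → Fin size → ℕ
  edgesBetween i j = sum (λ u → countB (edgeFrom i j u))

  edgesBetween≡ : ∀ i j → edgesBetween i j ≡ classSize G class i * degree i j
  edgesBetween≡ i j = sum-cong-≗ (λ u → countB-cong (λ v → ∧-assoc (class u =ᵇ i) (E G u v) (class v =ᵇ j))
                                      ∙ countB-∧ˡ (class u =ᵇ i) (λ v → E G u v ∧ (class v =ᵇ j)) ∙ by-class u)
                    ∙ sum-indicator (λ u → class u =ᵇ i) (degree i j)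
    where
    by-class : ∀ u → (if class u =ᵇ i then classDegree G class u j else 0) ≡ (if class u =ᵇ i then degree i j else 0)
    by-class u with class u =ᵇ i in class≡i
    ... | true  = classDegree≡degree u j ∙ cong (λ c → degree c j) (=ᵇ⇒≡ class≡i)
    ... | false = refl

  edgesBetween-sym : ∀ i j → edgesBetween i j ≡ edgesBetween j i
  edgesBetween-sym i j = countB-swap (edgeFrom i j) ∙ sum-cong-≗ (λ v → countB-cong (λ u → edgeFrom-flip i j u v))

  parameters : Parameters
  parameters = record
    { classes = size
    ; pred-size = pred-size
    ; degree = degree
    ; degree-balanced = λ i j → cong (degree i j *_) (sym (classSize≡ i)) ∙ *-comm (degree i j) _ ∙ sym (edgesBetween≡ i j)
                             ∙ edgesBetween-sym i j ∙ edgesBetween≡ j i ∙ *-comm _ (degree j i) ∙ cong (degree j i *_) (classSize≡ j)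
    ; degree≤size = λ i j → subst (degree i j ≤_) (classSize≡ j) (countB-∧≤ (E G (representative i)) (λ w → class w =ᵇ j))
    ; self-degree<size = λ i → ≤-pred (subst (degree i i <_) (classSize≡ i)
        (countB-mono-< _ (λ w → class w =ᵇ i) (λ w → proj₂ ∘ ∧-true {E G (representative i) w}) (representative i)
           (cong (_∧ (class (representative i) =ᵇ i)) (loopless G (representative i))) (cong (_=ᵇ i) (class-representative i) ∙ =ᵇ-refl i)))
    ; self-degree-even = λ i → let (e , even) = handshake (edgeFrom i i) (edgeFrom-flip i i) (no-loop i) in
        e , (*-comm (degree i i) _ ∙ cong (_* degree i i) (sym (classSize≡ i)) ∙ sym (edgesBetween≡ i i) ∙ even)
    }
    where
    no-loop : ∀ i u → edgeFrom i i u u ≡ false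
    no-loop i u = cong (λ e → ((class u =ᵇ i) ∧ e) ∧ (class u =ᵇ i)) (loopless G u)
                ∙ cong (_∧ (class u =ᵇ i)) (∧-zeroʳ (class u =ᵇ i))

  open Realisation parameters

  module G↔H = Transfer G H class block (λ c → classSize≡ c ∙ sym (block-size c))
    (λ u₁ u₂ same c → classDegree≡degree u₁ c ∙ cong (λ c′ → degree c′ c) same ∙ sym (block-degree u₂ c))

  Π-equitable : Equitable H Π
  Π-equitable u v same c = block-degree u c ∙ cong (λ c′ → degree c′ c) same ∙ sym (block-degree v c)

  -- The colour of representative (block u) is C²-definable in G, hence in H, and equitable partitions respect C².
  Π-coarsest : ∀ Π′ → Equitable H Π′ → Refines Π′ Π
  Π-coarsest Π′ equitable u v same = sym (class-representative (block u)) ∙ related⇒class≡ a b Sab ∙ class-representative (block v)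
    where
    a b : V G
    a = representative (block u)
    b = representative (block v)
    colour-at : ∀ w → eval G (colourF rounds a vx) (assignX G w) ≡ Same a w
    colour-at w = eval-colourF rounds a vx (assignX G w) w refl
    Sab : Same a b ≡ true
    Sab = sym (colour-at b)
        ∙ G↔H.Matched⇒same-eval (colourF rounds a vx) (G↔H.Matched-assignX (class-representative (block v)))
        ∙ sym (equitable⇒same-eval H Π′ equitable (colourF rounds a vx) same)
        ∙ sym (G↔H.Matched⇒same-eval (colourF rounds a vx) (G↔H.Matched-assignX (class-representative (block u))))
        ∙ colour-at a ∙ sameColour-refl rounds a

theorem3p3 : (G : Graph) → Σ Graph λ H → C2Equiv G H × Σ (Partition H) λ Π → IsCoarsestEquitable H Π × MultiCirculant H Π
theorem3p3 G = H , G↔H.C2-equivalent , Π , (Π-equitable , Π-coarsest) , σ , σ-automorphism , σ-cycles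
  where
  open StableColouring G
  open Realisation parameters
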